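{- Let $\mathcal{F}'$ and $\mathcal{F}''$ be $q$-exponential families and let $\mathcal{F}=\mathcal{F}'\oplus\mathcal{F}''$ be their merger. Then their two-variable hand enumerators satisfy, as formal power series in $x,y$, \[ \mathcal{H}(x,y)=\mathcal{H}'(x,y)\,\mathcal{H}''(x,y). \]
   Context: Fix a finite field $\mathbf{F}_q$. Let $\mathbf{F}_q^{(\mathbf{N})}$ be the vector space of infinite sequences $(a_1,a_2,\dots)$ over $\mathbf{F}_q$ with finitely many nonzero entries, with standard basis $e_1,e_2,\dots$, and let $E_n=\mathrm{span}(e_1,\dots,e_n)$ (so $E_0=0$). Fix an abstract set $P$ of "pictures". A $q$-card $Q(V,p)$ is a pair of a subspace $V\subset\mathbf{F}_q^{(\mathbf{N})}$ (its label space) and a picture $p\in P$; its dimension is $\dim V$; it is standard if $V=E_{\dim V}$. A card $Q(V',p)$ is a relabeling of $Q(V,p)$ if $\dim V'=\dim V$ (same picture). A $q$-deck of dimension $n$ is a finite set of standard cards all of dimension $n$ with pairwise different pictures. A $q$-exponential family $\mathcal{F}$ is a sequence of $q$-decks $\mathcal{D}_1,\mathcal{D}_2,\dots$ with $\mathcal{D}_n$ of dimension $n$ (possibly empty). A hand of $\mathcal{F}$ of dimension $n$ is a finite set of cards, each a relabeling of a card in some deck of $\mathcal{F}$, whose label spaces form a direct sum decomposition of $E_n$. The merger $\mathcal{F}'\oplus\mathcal{F}''$ of two families is the family whose deck of dimension $n$ is the disjoint union of $\mathcal{D}'_n$ and $\mathcal{D}''_n$. Let $\gamma_n=|\mathrm{GL}_n(\mathbf{F}_q)|=\prod_{i=0}^{n-1}(q^n-q^i)$,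 with $\gamma_0=1$. The hand enumerator of a family is $\mathcal{H}(x,y)=\sum_{n,k\ge0}h(n,k)\frac{x^n}{\gamma_n}y^k$, where $h(n,k)$ is the number of hands of dimension $n$ with $k$ cards, with the convention $h(0,0)=1$ and $h(n,0)=h(0,k)=0$ for $n,k>0$. $\mathcal{H}',\mathcal{H}''$ denote the hand enumerators of $\mathcal{F}',\mathcal{F}''$. -}

module Defs where

open import Level using (0ℓ)
open import Data.Bool using (Bool; true; T)
open import Data.Empty using (⊥; ⊥-elim)
open import Data.Fin using (Fin; zero; suc)
open import Data.Nat as ℕ using (ℕ; zero; suc; _∸_; _^_; _<_; NonZero)
open import Data.Nat.Properties using (m<n⇒0<n∸m; ^-monoʳ-<; m*n≢0; m<n⇒m<1+n; ≤-refl)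
open import Data.Integer using (+_)
open import Data.Rational as ℚ using (ℚ)
open import Data.Product using (Σ; Σ-syntax; ∃; ∃-syntax; _×_; _,_)
open import Data.Sum using (_⊎_; inj₁; inj₂)
open import Data.Vec using (Vec; replicate; zipWith; map)
open import Function using (_∘_)
open import Function.Bundles using (_↔_; Inverse)
open import Algebra.Core using (Op₁; Op₂)
open import Algebra.Structures using (IsCommutativeRing)
open import Relation.Nullary using (¬_)
open import Relation.Binary.PropositionalEquality
  using (_≡_; _≢_; refl; sym; trans; cong)

record FiniteField : Set₁ where
  infixl 6 _+_
  infixl 7 _*_
  field
    Carrier : Set
    _+_ _*_ : Op₂ Carrier
    -_      : Op₁ Carrier
    0# 1#   : Carrier
    isCommutativeRing : IsCommutativeRing _≡_ _+_ _*_ -_ 0# 1#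
    0≢1     : 0# ≢ 1#
    inverse : ∀ x → x ≢ 0# → Σ[ y ∈ Carrier ] x * y ≡ 1#
    q       : ℕ
    enum    : Carrier ↔ Fin q

-- Σ_{i=0}^{n} f i  (inclusive upper bound)
sumTo : ℕ → (ℕ → ℚ) → ℚ
sumTo zero    f = f 0
sumTo (suc n) f = sumTo n f ℚ.+ f (suc n)

prodBelow : ℕ → (ℕ → ℕ) → ℕ
prodBelow zero    f = 1
prodBelow (suc n) f = prodBelow n f ℕ.* f n

-- γ_n = |GL_n(F_q)| = Π_{i=0}^{n-1} (q^n - q^i), γ_0 = 1
γ : ℕ → ℕ → ℕ
γ q n = prodBelow n (λ i → q ^ n ∸ q ^ i)

-- Linear algebra in F_q^n (F_q^n = E_n ⊂ F_q^(N), all hands of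
-- dimension n live inside E_n)

module LinAlg (K : FiniteField) where
  open FiniteField K

  Vect : ℕ → Set
  Vect n = Vec Carrier n

  0ᵛ : ∀ {n} → Vect n
  0ᵛ = replicate _ 0#

  _+ᵛ_ : ∀ {n} → Vect n → Vect n → Vect n
  _+ᵛ_ = zipWith _+_

  _·ᵛ_ : ∀ {n} → Carrier → Vect n → Vect n
  c ·ᵛ v = map (c *_) v

  sumᵛ : ∀ {n d} → (Fin d → Vect n) → Vect n
  sumᵛ {d = zero}  w = 0ᵛ
  sumᵛ {d = suc d} w = w zero +ᵛ sumᵛ (w ∘ suc)

  lincomb : ∀ {n d} → (Fin d → Carrier) → (Fin d → Vect n) → Vect n
  lincomb c b = sumᵛ (λ i → c i ·ᵛ b i)

  LinIndep : ∀ {n d} → (Fin d → Vect n) → Set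
  LinIndep b = ∀ c → lincomb c b ≡ 0ᵛ → ∀ i → c i ≡ 0#

  Subset : ℕ → Set
  Subset n = Vect n → Bool

  IsBasis : ∀ {n d} → Subset n → (Fin d → Vect n) → Set
  IsBasis V b = LinIndep b × (∀ v → (T (V v) → ∃[ c ] lincomb c b ≡ v)
                                  × (∃[ c ] lincomb c b ≡ v → T (V v)))

  HasDim : ∀ {n} → Subset n → ℕ → Set
  HasDim {n} V d = Σ[ b ∈ (Fin d → Vect n) ] IsBasis V b

  DirectSumDecomp : ∀ {n k} → (Fin k → Subset n) → Set
  DirectSumDecomp {n} {k} Vs =
      (∀ v → Σ[ w ∈ (Fin k → Vect n) ] (∀ i → T (Vs i (w i))) × sumᵛ w ≡ v)
    × (∀ (w : Fin k → Vect n) → (∀ i → T (Vs i (w i))) → sumᵛ w ≡ 0ᵛ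
         → ∀ i → w i ≡ 0ᵛ)

-- q-exponential families.  Pictures of a family form a type Pic;
-- deck n p = true means the standard card Q(E_n, p) is in deck D_n.

record Family : Set₁ where
  field
    Pic        : Set
    deck       : ℕ → Pic → Bool
    deck0Empty : ∀ p → ¬ T (deck 0 p)

FiniteDecks : Family → Set
FiniteDecks F = ∀ n → Σ[ m ∈ ℕ ] ((Σ[ p ∈ Pic ] T (deck n p)) ↔ Fin m)
  where open Family F

_⊕_ : Family → Family → Family
F₁ ⊕ F₂ = record
  { Pic        = Pic F₁ ⊎ Pic F₂
  ; deck       = d
  ; deck0Empty = e
  }
  where
  open Family
  d : ℕ → Pic F₁ ⊎ Pic F₂ → Bool
  d n (inj₁ p) = deck F₁ n p
  d n (inj₂ p) = deck F₂ n p
  e : ∀ p → ¬ T (d 0 p)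
  e (inj₁ p) = deck0Empty F₁ p
  e (inj₂ p) = deck0Empty F₂ p

module Hands (K : FiniteField) (F : Family) where
  open FiniteField K
  open LinAlg K
  open Family F

  -- a card with label space V ⊂ E_n = F_q^n which is a relabeling of a
  -- card in the deck of dimension dim V
  record Card (n : ℕ) : Set where
    field
      label   : Subset n
      picture : Pic
      dim     : ℕ
      hasDim  : HasDim label dim
      inDeck  : T (deck dim picture)

  _≈ᶜ_ : ∀ {n} → Card n → Card n → Set
  c ≈ᶜ c' = (∀ v → Card.label c v ≡ Card.label c' v)
          × Card.picture c ≡ Card.picture c'

  -- a hand of dimension n with k cards: a set of k (distinct) cards
  -- (given by an enumeration) whose label spaces decompose E_n
  record Hand (n k : ℕ) : Set where
    field
      cards    : Fin k → Card n
      distinct : ∀ i j → cards i ≈ᶜ cards j → i ≡ j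
      decomp   : DirectSumDecomp (λ i → Card.label (cards i))

  _≈ʰ_ : ∀ {n k} → Hand n k → Hand n k → Set
  _≈ʰ_ {k = k} H H' =
    Σ[ σ ∈ Fin k ↔ Fin k ]
      (∀ i → Hand.cards H (Inverse.to σ i) ≈ᶜ Hand.cards H' i)

HasCard : {A : Set} → (A → A → Set) → ℕ → Set
HasCard {A} _≈_ m =
  Σ[ f ∈ (Fin m → A) ] ((∀ a → ∃[ i ] f i ≈ a)
                       × (∀ i j → f i ≈ f j → i ≡ j))

IsHandCount : FiniteField → Family → (ℕ → ℕ → ℕ) → Set
IsHandCount K F h = ∀ n k → HasCard (_≈ʰ_ {n} {k}) (h n k)
  where open Hands K F

q≥2 : (K : FiniteField) → Σ[ r ∈ ℕ ] FiniteField.q K ≡ suc (suc r)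
q≥2 K with FiniteField.q K | FiniteField.enum K
... | zero | σ with Inverse.to σ (FiniteField.0# K)
...   | ()
q≥2 K | suc zero | σ = ⊥-elim (FiniteField.0≢1 K eq)
  where
  open FiniteField K using (0#; 1#)
  t0 : Inverse.to σ 0# ≡ Inverse.to σ 1#
  t0 with Inverse.to σ 0# | Inverse.to σ 1#
  ... | zero | zero = refl
  eq : 0# ≡ 1#
  eq = trans (sym (Inverse.strictlyInverseʳ σ 0#))
         (trans (cong (Inverse.from σ) t0) (Inverse.strictlyInverseʳ σ 1#))
q≥2 K | suc (suc r) | σ = r , refl

prodBelow-nonZero : ∀ n f → (∀ i → i < n → NonZero (f i)) → NonZero (prodBelow n f)
prodBelow-nonZero zero    f h = _
prodBelow-nonZero (suc n) f h =
  m*n≢0 (prodBelow n f) (f n)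
    {{prodBelow-nonZero n f (λ i i<n → h i (m<n⇒m<1+n i<n))}}
    {{h n ≤-refl}}

γ-nonZero′ : ∀ r n → NonZero (γ (suc (suc r)) n)
γ-nonZero′ r n = prodBelow-nonZero n _
  (λ i i<n → ℕ.>-nonZero (m<n⇒0<n∸m (^-monoʳ-< (suc (suc r)) (ℕ.s≤s (ℕ.s≤s ℕ.z≤n)) i<n)))

γ-nonZero : (K : FiniteField) → ∀ n → NonZero (γ (FiniteField.q K) n)
γ-nonZero K n with FiniteField.q K | q≥2 K
... | _ | r , refl = γ-nonZero′ r n

-- Coefficients of the hand enumerator:  [x^n y^k] H(x,y) = h(n,k) / γ_n

coeff : (K : FiniteField) → (ℕ → ℕ → ℕ) → ℕ → ℕ → ℚ
coeff K h n k = (+ h n k ℚ./ γ (FiniteField.q K) n) {{γ-nonZero K n}}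

productCoeff : (ℕ → ℕ → ℚ) → (ℕ → ℕ → ℚ) → ℕ → ℕ → ℚ
productCoeff a b n k =
  sumTo n (λ i → sumTo k (λ j → a i j ℚ.* b (n ∸ i) (k ∸ j)))

-- Double counting.  Say a hand of F′ ⊕ F″ of dimension n with k cards has type (i , j) if it has
-- j cards from F′ and their labels have total dimension i; write i₂ = n - i and j₂ = k - j.  Count
-- the pairs of a hand H of type (i , j) and an ordered basis u ++ w of E_n such that u spans the
-- labels of the F′-cards of H and w those of its F″-cards.  Since these two sums of labels are
-- complementary subspaces of dimensions i and i₂, each such H admits γ_i γ_{i₂} bases.  On the
-- other hand, relabelling a hand of F′ of dimension i with j cards along u and a hand of F″ of
-- dimension i₂ with j₂ cards along w, and taking all the cards together, is a bijection from
-- (basis , hand , hand) onto these pairs, so there are γ_n h′(i , j) h″(i₂ , j₂) of them.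
-- Dividing by γ_n and summing over all types gives the coefficient of x^n y^k in H′ H″.
module Submission where

open import Defs
open import Level using (0ℓ)
open import Algebra.Bundles using (Monoid; CommutativeRing; CommutativeMonoid)
import Algebra.Properties.CommutativeMonoid.Sum
open import Data.Bool using (Bool; true; false; T; not; if_then_else_; _∧_)
open import Data.Empty using (⊥-elim)
open import Data.Fin as Fin using (Fin; zero; suc; _↑ˡ_; _↑ʳ_; splitAt)
open import Data.Fin.Properties
  using (injective⇒≤; *↔×; +↔⊎; any?; inj⇒≟; suc-injective; splitAt⁻¹-↑ˡ; splitAt⁻¹-↑ʳ; splitAt-↑ˡ; splitAt-↑ʳ;
         ↑ˡ-injective; ↑ʳ-injective)
import Data.Integer as ℤ
import Data.Integer.Properties as ℤ
open import Data.Nat as ℕ using (ℕ; zero; suc; _^_; _∸_; _≤_; z≤n; s≤s; NonZero; _≟_)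
import Data.Nat.Properties as ℕ
open import Data.Nat.Tactic.RingSolver using (solve-∀)
open import Data.Product using (Σ; Σ-syntax; ∃; ∃₂; ∃-syntax; _×_; _,_; proj₁; proj₂; uncurry)
open import Data.Product.Function.NonDependent.Propositional using (_×-↔_)
open import Data.Product.Relation.Binary.Pointwise.NonDependent using (Pointwise)
open import Data.Rational as ℚ using (ℚ; toℚᵘ)
import Data.Rational.Properties as ℚ
open import Data.Rational.Unnormalised as ℚᵘ using (ℚᵘ; mkℚᵘ; *≡*; _≃_)
import Data.Rational.Unnormalised.Properties as ℚᵘ
open import Data.Sum using (_⊎_; inj₁; inj₂; [_,_]′)
open import Data.Sum.Function.Propositional using (_⊎-↔_)
open import Data.Sum.Properties using (inj₁-injective; inj₂-injective)
open import Data.Unit using (tt)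
open import Data.Vec as Vec using (Vec; []; _∷_; lookup; tabulate; head; tail)
open import Data.Vec.Properties
  using (lookup-zipWith; lookup-map; lookup-replicate; lookup∘tabulate; tabulate∘lookup; tabulate-cong;
         zipWith-comm; zipWith-assoc; zipWith-identityˡ; zipWith-identityʳ)
open import Data.Vec.Functional using () renaming (_++_ to _++ᶠ_; _∷_ to _◂_)
open import Data.Vec.Functional.Properties using (lookup-++ˡ; lookup-++ʳ)
open import Function using (_∘_; _on_)
open import Function.Bundles using (Inverse; _↔_; mk↔ₛ′)
open import Function.Properties.Inverse using (↔-sym; ↔-trans; ↔⇒↣)
open import Function.Related.TypeIsomorphisms using (⊎-comm)
open import Relation.Binary using (DecidableEquality; tri<; tri≈; tri>)
open import Relation.Binary.Bundles using (Setoid)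
open import Relation.Binary.PropositionalEquality
import Relation.Binary.Reasoning.Setoid
open import Relation.Nullary using (¬_; yes; no; does; ¬?; contradiction)
open import Relation.Nullary.Decidable using (map′; isYes; toWitness; fromWitness; _×-dec_; dec-true; dec-false)
open import Relation.Nullary.Decidable.Core using (T?)
open import Relation.Unary using (Pred; Decidable; ∁)

open import Algebra.Properties.CommutativeMonoid.Sum ℕ.+-0-commutativeMonoid public
  using () renaming (sum to ∑ℕ; sum-cong-≗ to ∑ℕ-cong; sum-permute to ∑ℕ-permute; ∑-distrib-+ to ∑ℕ-distrib-+)

module _ {c ℓ} (M : Monoid c ℓ) where
  open Monoid M using (Carrier; _≈_; _∙_; identityˡ; assoc; ∙-congˡ) renaming (sym to ≈-sym; trans to ≈-trans)
  open import Algebra.Properties.Monoid.Sum M using (sum)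

  sum-↑ : ∀ {a b} (f : Fin (a ℕ.+ b) → Carrier) → sum f ≈ sum (f ∘ (_↑ˡ b)) ∙ sum (f ∘ (a ↑ʳ_))
  sum-↑ {zero}  f = ≈-sym (identityˡ _)
  sum-↑ {suc a} f = ≈-trans (∙-congˡ (sum-↑ {a} (f ∘ suc))) (≈-sym (assoc _ _ _))

↑-elim : ∀ {a b ℓ} {P : Fin (a ℕ.+ b) → Set ℓ} → (∀ l → P (l ↑ˡ b)) → (∀ l → P (a ↑ʳ l)) → ∀ p → P p
↑-elim {a} {P = P} left right p with splitAt a p in eq
... | inj₁ l = subst P (splitAt⁻¹-↑ˡ eq) (left l)
... | inj₂ l = subst P (splitAt⁻¹-↑ʳ eq) (right l)

module Blocks {A : Set} where

  concatᶠ : ∀ {k} (d : Fin k → ℕ) → ((l : Fin k) → Fin (d l) → A) → Fin (∑ℕ d) → A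
  concatᶠ {zero}  d b ()
  concatᶠ {suc k} d b = b zero ++ᶠ concatᶠ (d ∘ suc) (b ∘ suc)

  block : ∀ {k} (d : Fin k → ℕ) → (Fin (∑ℕ d) → A) → (l : Fin k) → Fin (d l) → A
  block {suc k} d c zero    = c ∘ (_↑ˡ _)
  block {suc k} d c (suc l) = block (d ∘ suc) (c ∘ (d zero ↑ʳ_)) l

  block-cong : ∀ {k} (d : Fin k → ℕ) {c c′ : Fin (∑ℕ d) → A} → c ≗ c′ → ∀ l → block d c l ≗ block d c′ l
  block-cong {suc k} d eq zero    t = eq _
  block-cong {suc k} d eq (suc l) t = block-cong (d ∘ suc) (eq ∘ (d zero ↑ʳ_)) l t

  block-concatᶠ : ∀ {k} (d : Fin k → ℕ) (b : (l : Fin k) → Fin (d l) → A) l → block d (concatᶠ d b) l ≗ b l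
  block-concatᶠ {suc k} d b zero    = lookup-++ˡ (b zero) (concatᶠ (d ∘ suc) (b ∘ suc))
  block-concatᶠ {suc k} d b (suc l) t =
    trans (block-cong (d ∘ suc) (lookup-++ʳ (b zero) (concatᶠ (d ∘ suc) (b ∘ suc))) l t)
          (block-concatᶠ (d ∘ suc) (b ∘ suc) l t)

  block-all : ∀ {k} (d : Fin k → ℕ) {P : A → Set} (c : Fin (∑ℕ d) → A) →
    (∀ l t → P (block d c l t)) → ∀ p → P (c p)
  block-all {suc k} d {P} c all = ↑-elim {P = P ∘ c} (all zero) (block-all (d ∘ suc) {P} (c ∘ (d zero ↑ʳ_)) (all ∘ suc))

isInj₁ : {A B : Set} → A ⊎ B → Bool
isInj₁ (inj₁ _) = true
isInj₁ (inj₂ _) = false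

module RestrictPermutation {a b} (σ : Fin (a ℕ.+ b) ↔ Fin (a ℕ.+ b))
  (σ-preserves : ∀ t → isInj₁ (splitAt a (Inverse.to σ t)) ≡ isInj₁ (splitAt a t)) where
  open Inverse σ

  private
    σ⁻¹-preserves : ∀ t → isInj₁ (splitAt a (from t)) ≡ isInj₁ (splitAt a t)
    σ⁻¹-preserves t = trans (sym (σ-preserves (from t))) (cong (isInj₁ ∘ splitAt a) (strictlyInverseˡ t))

    left : ∀ t → isInj₁ (splitAt a t) ≡ true → ∃ λ (x : Fin a) → t ≡ x ↑ˡ b
    left t _ with splitAt a t in eq
    ... | inj₁ x = x , sym (splitAt⁻¹-↑ˡ eq)

    right : ∀ t → isInj₁ (splitAt a t) ≡ false → ∃ λ (y : Fin b) → t ≡ a ↑ʳ y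
    right t _ with splitAt a t in eq
    ... | inj₂ y = y , sym (splitAt⁻¹-↑ʳ eq)

    onLeft : ∀ x → isInj₁ (splitAt a (x ↑ˡ b)) ≡ true
    onLeft x = cong isInj₁ (splitAt-↑ˡ a x b)

    onRight : ∀ y → isInj₁ (splitAt a (a ↑ʳ y)) ≡ false
    onRight y = cong isInj₁ (splitAt-↑ʳ a b y)

    toˡ fromˡ : ∀ (x : Fin a) → ∃ λ x′ → _ ≡ x′ ↑ˡ b
    toˡ x = left (to (x ↑ˡ b)) (trans (σ-preserves (x ↑ˡ b)) (onLeft x))
    fromˡ x = left (from (x ↑ˡ b)) (trans (σ⁻¹-preserves (x ↑ˡ b)) (onLeft x))

    toʳ fromʳ : ∀ (y : Fin b) → ∃ λ y′ → _ ≡ a ↑ʳ y′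
    toʳ y = right (to (a ↑ʳ y)) (trans (σ-preserves (a ↑ʳ y)) (onRight y))
    fromʳ y = right (from (a ↑ʳ y)) (trans (σ⁻¹-preserves (a ↑ʳ y)) (onRight y))

  σˡ : Fin a ↔ Fin a
  σˡ = mk↔ₛ′ (proj₁ ∘ toˡ) (proj₁ ∘ fromˡ)
    (λ x → ↑ˡ-injective b _ _ (trans (sym (proj₂ (toˡ (proj₁ (fromˡ x)))))
                                      (trans (cong to (sym (proj₂ (fromˡ x)))) (strictlyInverseˡ (x ↑ˡ b)))))
    (λ x → ↑ˡ-injective b _ _ (trans (sym (proj₂ (fromˡ (proj₁ (toˡ x)))))
                                      (trans (cong from (sym (proj₂ (toˡ x)))) (strictlyInverseʳ (x ↑ˡ b)))))

  σʳ : Fin b ↔ Fin b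
  σʳ = mk↔ₛ′ (proj₁ ∘ toʳ) (proj₁ ∘ fromʳ)
    (λ y → ↑ʳ-injective a _ _ (trans (sym (proj₂ (toʳ (proj₁ (fromʳ y)))))
                                      (trans (cong to (sym (proj₂ (fromʳ y)))) (strictlyInverseˡ (a ↑ʳ y)))))
    (λ y → ↑ʳ-injective a _ _ (trans (sym (proj₂ (fromʳ (proj₁ (toʳ y)))))
                                      (trans (cong from (sym (proj₂ (toʳ y)))) (strictlyInverseʳ (a ↑ʳ y)))))

  σ-↑ˡ : ∀ x → to (x ↑ˡ b) ≡ Inverse.to σˡ x ↑ˡ b
  σ-↑ˡ x = proj₂ (toˡ x)

  σ-↑ʳ : ∀ y → to (a ↑ʳ y) ≡ a ↑ʳ Inverse.to σʳ y
  σ-↑ʳ y = proj₂ (toʳ y)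

2+r^-injective : ∀ r {a b} → suc (suc r) ^ a ≡ suc (suc r) ^ b → a ≡ b
2+r^-injective r {a} {b} eq with ℕ.<-cmp a b
... | tri< a<b _ _ = ⊥-elim (ℕ.<-irrefl eq (ℕ.^-monoʳ-< (suc (suc r)) (s≤s (s≤s z≤n)) a<b))
... | tri≈ _ a≡b _ = a≡b
... | tri> _ _ b<a = ⊥-elim (ℕ.<-irrefl (sym eq) (ℕ.^-monoʳ-< (suc (suc r)) (s≤s (s≤s z≤n)) b<a))

T⇔⇒≡ : ∀ {a b : Bool} → (T a → T b) → (T b → T a) → a ≡ b
T⇔⇒≡ {true}  {true}  _ _ = refl
T⇔⇒≡ {true}  {false} f _ = ⊥-elim (f tt)
T⇔⇒≡ {false} {true}  _ g = ⊥-elim (g tt)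
T⇔⇒≡ {false} {false} _ _ = refl

¬T⇒T-not : ∀ {b} → ¬ T b → T (not b)
¬T⇒T-not {false} _  = tt
¬T⇒T-not {true}  ¬t = ¬t tt

T-not⇒¬T : ∀ {b} → T (not b) → ¬ T b
T-not⇒¬T {false} _ ()

module Counting where

  module _ {A : Set} {R : A → A → Set}
           (R-sym : ∀ {a b} → R a b → R b a)
           (R-trans : ∀ {a b c} → R a b → R b c → R a c) where

    HasCard-≤ : ∀ {m m′} → HasCard R m → HasCard R m′ → m ≤ m′
    HasCard-≤ (f , f-surj , f-inj) (g , g-surj , _) = injective⇒≤ {f = φ} φ-inj
      where
      φ = λ l → proj₁ (g-surj (f l))
      φ-inj : ∀ {x y} → φ x ≡ φ y → x ≡ y
      φ-inj {x} {y} eq = f-inj x y (R-trans (R-sym (proj₂ (g-surj (f x))))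
        (subst (λ z → R (g z) (f y)) (sym eq) (proj₂ (g-surj (f y)))))

    HasCard-unique : ∀ {m m′} → HasCard R m → HasCard R m′ → m ≡ m′
    HasCard-unique c c′ = ℕ.≤-antisym (HasCard-≤ c c′) (HasCard-≤ c′ c)

  HasCard-map : {A B : Set} {R : A → A → Set} {S : B → B → Set} (f : A → B)
    → (∀ {a a′} → R a a′ → S (f a) (f a′))
    → (∀ {a a′} → S (f a) (f a′) → R a a′)
    → (∀ b → Σ A λ a → S (f a) b)
    → (∀ {x y z} → S x y → S y z → S x z)
    → ∀ {m} → HasCard R m → HasCard S m
  HasCard-map f preserves reflects surj S-trans (e , e-surj , e-inj) =
    f ∘ e ,
    (λ b → let (a , fa≈b) = surj b ; (l , el≈a) = e-surj a in l , S-trans (preserves el≈a) fa≈b) ,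
    (λ i j s → e-inj i j (reflects s))

  HasCard-↔ : {A X : Set} {R : A → A → Set} {m : ℕ} (ι : Fin m ↔ X) (E : X → A)
    → (∀ a → Σ X λ x → R (E x) a)
    → (∀ x y → R (E x) (E y) → x ≡ y)
    → HasCard R m
  HasCard-↔ {R = R} ι E surj inj =
    E ∘ to ,
    (λ a → let (x , Ex≈a) = surj a in from x , subst (λ z → R (E z) a) (sym (strictlyInverseˡ x)) Ex≈a) ,
    (λ s t r → trans (sym (strictlyInverseʳ s)) (trans (cong from (inj _ _ r)) (strictlyInverseʳ t)))
    where open Inverse ι

  HasCard-≡ : {A : Set} {m : ℕ} → Fin m ↔ A → HasCard {A} _≡_ m
  HasCard-≡ ι = HasCard-↔ ι (λ a → a) (λ a → a , refl) (λ _ _ eq → eq)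

  HasCard-× : {A B : Set} {R : A → A → Set} {S : B → B → Set} {m n : ℕ}
    → HasCard R m → HasCard S n
    → HasCard (Pointwise R S) (m ℕ.* n)
  HasCard-× {R = R} {S} (e , e-surj , e-inj) (f , f-surj , f-inj) =
    HasCard-↔ {R = Pointwise R S} *↔× (λ (l , s) → e l , f s)
      (λ (a , b) → (proj₁ (e-surj a) , proj₁ (f-surj b)) , proj₂ (e-surj a) , proj₂ (f-surj b))
      (λ (l , s) (l′ , s′) (r , r′) → cong₂ _,_ (e-inj l l′ r) (f-inj s s′ r′))

  HasCard-Σ : {A B : Set} {R : A → A → Set} {S : B → B → Set} (P : A → B → Set)
    → (∀ {a a′ b} → R a a′ → P a′ b → P a b)
    → ∀ {m n} → HasCard R m
    → (∀ a → HasCard {Σ B (P a)} (S on proj₁) n)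
    → HasCard {Σ A (λ a → Σ B (P a))} (λ x y → R (proj₁ x) (proj₁ y) × S (proj₁ (proj₂ x)) (proj₁ (proj₂ y))) (m ℕ.* n)
  HasCard-Σ {R = R} {S} P P-resp (e , e-surj , e-inj) fibre = HasCard-↔ {R = RS} *↔× E surj inj
    where
    RS = λ x y → R (proj₁ x) (proj₁ y) × S (proj₁ (proj₂ x)) (proj₁ (proj₂ y))
    E = λ (l , s) → e l , proj₁ (fibre (e l)) s
    surj = λ (a , b , p) →
      let (l , r) = e-surj a
          (s , r′) = proj₁ (proj₂ (fibre (e l))) (b , P-resp r p)
      in (l , s) , r , r′
    inj : ∀ x y → _
    inj (l , s) (l′ , s′) (r , r′) with e-inj l l′ r
    ... | refl = cong (l ,_) (proj₂ (proj₂ (fibre (e l))) s s′ r′)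

  HasCard-0⇒¬ : {A : Set} {R : A → A → Set} → HasCard R 0 → ¬ A
  HasCard-0⇒¬ (_ , surj , _) a with surj a
  ... | () , _

  count : ∀ {N ℓ} {P : Pred (Fin N) ℓ} → Decidable P → ℕ
  count P? = ∑ℕ (λ l → if does (P? l) then 1 else 0)

  count+count-∁ : ∀ {N ℓ} {P : Pred (Fin N) ℓ} (P? : Decidable P) → count P? ℕ.+ count (λ l → ¬? (P? l)) ≡ N
  count+count-∁ {zero}  P? = refl
  count+count-∁ {suc N} P? with P? zero
  ... | yes _ = cong suc (count+count-∁ (P? ∘ suc))
  ... | no  _ = trans (ℕ.+-suc _ _) (cong suc (count+count-∁ (P? ∘ suc)))

  sucΣ : ∀ {N} {P : Pred (Fin (suc N)) 0ℓ} → Σ (Fin N) (P ∘ suc) → Σ (Fin (suc N)) P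
  sucΣ (l , p) = suc l , p

  HasCard-filterFin : ∀ {N} {P : Pred (Fin N) 0ℓ} (P? : Decidable P) →
    HasCard {Σ (Fin N) P} (_≡_ on proj₁) (count P?)
  HasCard-filterFin {zero} P? = (λ ()) , (λ ()) , (λ ())
  HasCard-filterFin {suc N} {P = P} P? with P? zero | HasCard-filterFin (P? ∘ suc)
  ... | yes p | g , g-surj , g-inj = enum , surj , inj
    where
    enum : Fin (suc (count (P? ∘ suc))) → Σ (Fin (suc N)) P
    enum zero    = zero , p
    enum (suc t) = sucΣ (g t)
    surj : ∀ x → ∃ λ t → proj₁ (enum t) ≡ proj₁ x
    surj (zero , _)    = zero , refl
    surj (suc l , q) = let (t , eq) = g-surj (l , q) in suc t , cong suc eq
    inj : ∀ s t → proj₁ (enum s) ≡ proj₁ (enum t) → s ≡ t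
    inj zero    zero    _  = refl
    inj (suc s) (suc t) eq = cong suc (g-inj s t (suc-injective eq))
  ... | no ¬p | g , g-surj , g-inj = sucΣ ∘ g , surj , λ s t eq → g-inj s t (suc-injective eq)
    where
    surj : ∀ x → ∃ λ t → suc (proj₁ (g t)) ≡ proj₁ x
    surj (zero , q)  = contradiction q ¬p
    surj (suc l , q) = let (t , eq) = g-surj (l , q) in t , cong suc eq

  HasCard-filter : {A : Set} {R : A → A → Set} {N : ℕ} (hk : HasCard R N)
    {P : Pred A 0ℓ} (P? : Decidable P) → (∀ {a b} → R a b → P b → P a) →
    HasCard {Σ A P} (R on proj₁) (count (P? ∘ proj₁ hk))
  HasCard-filter {R = R} (e , e-surj , e-inj) P? P-resp =
    (λ t → let (l , p) = g t in e l , p) , surj , λ s t r → g-inj s t (e-inj _ _ r)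
    where
    open Σ (HasCard-filterFin (P? ∘ e)) renaming (proj₁ to g; proj₂ to g-prop)
    g-surj = proj₁ g-prop
    g-inj  = proj₂ g-prop
    surj : ∀ x → ∃ λ t → R (e (proj₁ (g t))) (proj₁ x)
    surj (a , pa) =
      let (l , r)  = e-surj a
          (t , eq) = g-surj (l , P-resp r pa)
      in t , subst (λ z → R (e z) a) (sym eq) r

  module _ {N a b} {P : Pred (Fin N) 0ℓ} (P? : Decidable P)
           (left : HasCard {Σ (Fin N) P} (_≡_ on proj₁) a)
           (right : HasCard {Σ (Fin N) (∁ P)} (_≡_ on proj₁) b) where
    private
      g₁ = proj₁ left
      g₁-surj = proj₁ (proj₂ left)
      g₁-inj = proj₂ (proj₂ left)
      g₂ = proj₁ right
      g₂-surj = proj₁ (proj₂ right)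
      g₂-inj = proj₂ (proj₂ right)

    partition↔ : Fin N ↔ (Fin a ⊎ Fin b)
    partition↔ = mk↔ₛ′ to [ proj₁ ∘ g₁ , proj₁ ∘ g₂ ]′ to∘from from∘to
      where
      to : Fin N → Fin a ⊎ Fin b
      to l with P? l
      ... | yes p = inj₁ (proj₁ (g₁-surj (l , p)))
      ... | no ¬p = inj₂ (proj₁ (g₂-surj (l , ¬p)))
      to∘from : ∀ x → to ([ proj₁ ∘ g₁ , proj₁ ∘ g₂ ]′ x) ≡ x
      to∘from (inj₁ t) with P? (proj₁ (g₁ t))
      ... | yes p = cong inj₁ (g₁-inj _ t (proj₂ (g₁-surj _)))
      ... | no ¬p = contradiction (proj₂ (g₁ t)) ¬p
      to∘from (inj₂ t) with P? (proj₁ (g₂ t))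
      ... | yes p = contradiction p (proj₂ (g₂ t))
      ... | no ¬p = cong inj₂ (g₂-inj _ t (proj₂ (g₂-surj _)))
      from∘to : ∀ l → [ proj₁ ∘ g₁ , proj₁ ∘ g₂ ]′ (to l) ≡ l
      from∘to l with P? l
      ... | yes p = proj₂ (g₁-surj (l , p))
      ... | no ¬p = proj₂ (g₂-surj (l , ¬p))

    partition↔-inj₁ : ∀ t → P (Inverse.from partition↔ (inj₁ t))
    partition↔-inj₁ t = proj₂ (g₁ t)

    partition↔-inj₂ : ∀ t → ¬ P (Inverse.from partition↔ (inj₂ t))
    partition↔-inj₂ t = proj₂ (g₂ t)

module Linear (K : FiniteField) where
  open FiniteField K
  open LinAlg K
  open Counting
  open Blocks

  commutativeRing : CommutativeRing 0ℓ 0ℓ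
  commutativeRing = record { isCommutativeRing = isCommutativeRing }

  open CommutativeRing commutativeRing
    using (+-assoc; +-comm; +-identityˡ; +-identityʳ; *-assoc; *-comm; distribʳ; zeroˡ; zeroʳ;
           *-identityˡ; *-identityʳ; -‿inverseˡ; -‿inverseʳ; ring; semiring)
  open import Algebra.Properties.Ring ring using (-1*x≈-x; +-inverseʳ-unique; -‿distribˡ-*; -‿distribʳ-*; -‿involutive)
  open import Algebra.Properties.Semiring.Sum semiring
    using (sum; sum-cong-≗; ∑-distrib-+; ∑-comm; *-distribˡ-sum; *-distribʳ-sum; sum-replicate-zero)

  _≟ᶜ_ : DecidableEquality Carrier
  _≟ᶜ_ = inj⇒≟ (↔⇒↣ enum)

  _≟ᵛ_ : ∀ {n} → DecidableEquality (Vect n)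
  _≟ᵛ_ = Data.Vec.Properties.≡-dec _≟ᶜ_

  c*x+z≡0⇒-c⁻¹*z≡x : ∀ {c c⁻¹ x z} → c * c⁻¹ ≡ 1# → c * x + z ≡ 0# → (- c⁻¹) * z ≡ x
  c*x+z≡0⇒-c⁻¹*z≡x {c} {c⁻¹} {x} {z} cc⁻¹≡1 eq = begin
    (- c⁻¹) * z           ≡⟨ cong ((- c⁻¹) *_) (+-inverseʳ-unique (c * x) z eq) ⟩
    (- c⁻¹) * (- (c * x)) ≡⟨ sym (-‿distribˡ-* c⁻¹ (- (c * x))) ⟩
    - (c⁻¹ * - (c * x))   ≡⟨ cong -_ (sym (-‿distribʳ-* c⁻¹ (c * x))) ⟩
    - (- (c⁻¹ * (c * x))) ≡⟨ -‿involutive _ ⟩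
    c⁻¹ * (c * x)         ≡⟨ sym (*-assoc c⁻¹ c x) ⟩
    (c⁻¹ * c) * x         ≡⟨ cong (_* x) (trans (*-comm c⁻¹ c) cc⁻¹≡1) ⟩
    1# * x                ≡⟨ *-identityˡ x ⟩
    x                     ∎
    where open ≡-Reasoning

  lookup-ext : ∀ {n} {v w : Vect n} → (∀ p → lookup v p ≡ lookup w p) → v ≡ w
  lookup-ext {v = v} {w} eq = trans (sym (tabulate∘lookup v)) (trans (tabulate-cong eq) (tabulate∘lookup w))

  lookup-+ᵛ : ∀ {n} (v w : Vect n) p → lookup (v +ᵛ w) p ≡ lookup v p + lookup w p
  lookup-+ᵛ v w p = lookup-zipWith _+_ p v w

  lookup-0ᵛ : ∀ {n} (p : Fin n) → lookup 0ᵛ p ≡ 0#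
  lookup-0ᵛ p = lookup-replicate p 0#

  lookup-·ᵛ : ∀ {n} c (v : Vect n) p → lookup (c ·ᵛ v) p ≡ c * lookup v p
  lookup-·ᵛ c v p = lookup-map p (c *_) v

  lookup-sumᵛ : ∀ {n d} (w : Fin d → Vect n) p → lookup (sumᵛ w) p ≡ sum (λ l → lookup (w l) p)
  lookup-sumᵛ {d = zero}  w p = lookup-0ᵛ p
  lookup-sumᵛ {d = suc d} w p =
    trans (lookup-+ᵛ (w zero) (sumᵛ (w ∘ suc)) p) (cong (lookup (w zero) p +_) (lookup-sumᵛ (w ∘ suc) p))

  lookup-lincomb : ∀ {n d} (c : Fin d → Carrier) (b : Fin d → Vect n) p →
    lookup (lincomb c b) p ≡ sum (λ l → c l * lookup (b l) p)
  lookup-lincomb c b p = trans (lookup-sumᵛ (λ l → c l ·ᵛ b l) p) (sum-cong-≗ (λ l → lookup-·ᵛ (c l) (b l) p))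

  +ᵛ-comm : ∀ {n} (v w : Vect n) → v +ᵛ w ≡ w +ᵛ v
  +ᵛ-comm = zipWith-comm +-comm

  +ᵛ-assoc : ∀ {n} (u v w : Vect n) → (u +ᵛ v) +ᵛ w ≡ u +ᵛ (v +ᵛ w)
  +ᵛ-assoc = zipWith-assoc +-assoc

  +ᵛ-identityˡ : ∀ {n} (v : Vect n) → 0ᵛ +ᵛ v ≡ v
  +ᵛ-identityˡ = zipWith-identityˡ +-identityˡ

  +ᵛ-identityʳ : ∀ {n} (v : Vect n) → v +ᵛ 0ᵛ ≡ v
  +ᵛ-identityʳ = zipWith-identityʳ +-identityʳ

  ·ᵛ-zeroˡ : ∀ {n} (v : Vect n) → 0# ·ᵛ v ≡ 0ᵛ
  ·ᵛ-zeroˡ v = lookup-ext λ p → trans (lookup-·ᵛ 0# v p) (trans (zeroˡ _) (sym (lookup-0ᵛ p)))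

  +ᵛ-commutativeMonoid : ℕ → CommutativeMonoid 0ℓ 0ℓ
  +ᵛ-commutativeMonoid n = record
    { Carrier = Vect n ; _≈_ = _≡_ ; _∙_ = _+ᵛ_ ; ε = 0ᵛ
    ; isCommutativeMonoid = record
      { isMonoid = record
        { isSemigroup = record
          { isMagma = record { isEquivalence = isEquivalence ; ∙-cong = cong₂ _+ᵛ_ }
          ; assoc = +ᵛ-assoc }
        ; identity = +ᵛ-identityˡ , +ᵛ-identityʳ }
      ; comm = +ᵛ-comm } }

  module ∑ᵛ (n : ℕ) = Algebra.Properties.CommutativeMonoid.Sum (+ᵛ-commutativeMonoid n)

  sumᵛ≡∑ᵛ : ∀ {n d} (w : Fin d → Vect n) → sumᵛ w ≡ ∑ᵛ.sum n w
  sumᵛ≡∑ᵛ {d = zero}  w = refl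
  sumᵛ≡∑ᵛ {d = suc d} w = cong (w zero +ᵛ_) (sumᵛ≡∑ᵛ (w ∘ suc))

  sumᵛ-↑ : ∀ {n a b} (w : Fin (a ℕ.+ b) → Vect n) → sumᵛ w ≡ sumᵛ (w ∘ (_↑ˡ b)) +ᵛ sumᵛ (w ∘ (a ↑ʳ_))
  sumᵛ-↑ {n} {a} {b} w = begin
    sumᵛ w                                           ≡⟨ sumᵛ≡∑ᵛ w ⟩
    ∑ᵛ.sum n w                                       ≡⟨ sum-↑ (CommutativeMonoid.monoid (+ᵛ-commutativeMonoid n)) {a} w ⟩
    ∑ᵛ.sum n (w ∘ (_↑ˡ b)) +ᵛ ∑ᵛ.sum n (w ∘ (a ↑ʳ_))  ≡⟨ cong₂ _+ᵛ_ (sumᵛ≡∑ᵛ (w ∘ (_↑ˡ b))) (sumᵛ≡∑ᵛ (w ∘ (a ↑ʳ_))) ⟨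
    sumᵛ (w ∘ (_↑ˡ b)) +ᵛ sumᵛ (w ∘ (a ↑ʳ_))         ∎
    where open ≡-Reasoning

  sumᵛ-cong : ∀ {n d} {w w′ : Fin d → Vect n} → w ≗ w′ → sumᵛ w ≡ sumᵛ w′
  sumᵛ-cong {d = zero}  eq = refl
  sumᵛ-cong {d = suc d} eq = cong₂ _+ᵛ_ (eq zero) (sumᵛ-cong (eq ∘ suc))

  sumᵛ-zero : ∀ {n d} {w : Fin d → Vect n} → (∀ l → w l ≡ 0ᵛ) → sumᵛ w ≡ 0ᵛ
  sumᵛ-zero {d = zero}  eq = refl
  sumᵛ-zero {d = suc d} eq = trans (cong₂ _+ᵛ_ (eq zero) (sumᵛ-zero (eq ∘ suc))) (+ᵛ-identityˡ 0ᵛ)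

  sumᵛ-+ᵛ : ∀ {n d} (w w′ : Fin d → Vect n) → sumᵛ (λ l → w l +ᵛ w′ l) ≡ sumᵛ w +ᵛ sumᵛ w′
  sumᵛ-+ᵛ {n} w w′ = begin
    sumᵛ (λ l → w l +ᵛ w′ l)       ≡⟨ sumᵛ≡∑ᵛ (λ l → w l +ᵛ w′ l) ⟩
    ∑ᵛ.sum n (λ l → w l +ᵛ w′ l)   ≡⟨ ∑ᵛ.∑-distrib-+ n w w′ ⟩
    ∑ᵛ.sum n w +ᵛ ∑ᵛ.sum n w′      ≡⟨ sym (cong₂ _+ᵛ_ (sumᵛ≡∑ᵛ w) (sumᵛ≡∑ᵛ w′)) ⟩
    sumᵛ w +ᵛ sumᵛ w′              ∎
    where open ≡-Reasoning

  single : ∀ {m k} → Fin k → Vect m → Fin k → Vect m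
  single zero    v zero     = v
  single zero    v (suc _)  = 0ᵛ
  single (suc l) v zero     = 0ᵛ
  single (suc l) v (suc l′) = single l v l′

  sumᵛ-single : ∀ {m k} (l : Fin k) (v : Vect m) → sumᵛ (single l v) ≡ v
  sumᵛ-single {k = suc k} zero    v = trans (cong (v +ᵛ_) (sumᵛ-zero {d = k} (λ _ → refl))) (+ᵛ-identityʳ v)
  sumᵛ-single {k = suc k} (suc l) v = trans (cong (0ᵛ +ᵛ_) (sumᵛ-single l v)) (+ᵛ-identityˡ v)

  single-cases : ∀ {m k} (l : Fin k) (v : Vect m) l′ → (l′ ≡ l × single l v l′ ≡ v) ⊎ single l v l′ ≡ 0ᵛ
  single-cases zero    v zero     = inj₁ (refl , refl)
  single-cases zero    v (suc l′) = inj₂ refl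
  single-cases (suc l) v zero     = inj₂ refl
  single-cases (suc l) v (suc l′) with single-cases l v l′
  ... | inj₁ (eq , eq′) = inj₁ (cong suc eq , eq′)
  ... | inj₂ eq         = inj₂ eq

  lincomb-cong : ∀ {n d} {c c′ : Fin d → Carrier} {b b′ : Fin d → Vect n} →
    c ≗ c′ → b ≗ b′ → lincomb c b ≡ lincomb c′ b′
  lincomb-cong {d = zero}  eqc eqb = refl
  lincomb-cong {d = suc d} eqc eqb = cong₂ _+ᵛ_ (cong₂ _·ᵛ_ (eqc zero) (eqb zero)) (lincomb-cong (eqc ∘ suc) (eqb ∘ suc))

  lincomb-+ : ∀ {n d} (c c′ : Fin d → Carrier) (b : Fin d → Vect n) →
    lincomb (λ l → c l + c′ l) b ≡ lincomb c b +ᵛ lincomb c′ b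
  lincomb-+ c c′ b = lookup-ext λ p → begin
    lookup (lincomb (λ l → c l + c′ l) b) p                         ≡⟨ lookup-lincomb _ b p ⟩
    sum (λ l → (c l + c′ l) * lookup (b l) p)                       ≡⟨ sum-cong-≗ (λ l → distribʳ (lookup (b l) p) (c l) (c′ l)) ⟩
    sum (λ l → c l * lookup (b l) p + c′ l * lookup (b l) p)        ≡⟨ ∑-distrib-+ (λ l → c l * lookup (b l) p) _ ⟩
    sum (λ l → c l * lookup (b l) p) + sum (λ l → c′ l * lookup (b l) p)
      ≡⟨ sym (cong₂ _+_ (lookup-lincomb c b p) (lookup-lincomb c′ b p)) ⟩
    lookup (lincomb c b) p + lookup (lincomb c′ b) p                ≡⟨ sym (lookup-+ᵛ (lincomb c b) (lincomb c′ b) p) ⟩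
    lookup (lincomb c b +ᵛ lincomb c′ b) p                          ∎
    where open ≡-Reasoning

  lincomb-· : ∀ {n d} a (c : Fin d → Carrier) (b : Fin d → Vect n) → lincomb (λ l → a * c l) b ≡ a ·ᵛ lincomb c b
  lincomb-· a c b = lookup-ext λ p → begin
    lookup (lincomb (λ l → a * c l) b) p     ≡⟨ lookup-lincomb _ b p ⟩
    sum (λ l → (a * c l) * lookup (b l) p)   ≡⟨ sum-cong-≗ (λ l → *-assoc a (c l) (lookup (b l) p)) ⟩
    sum (λ l → a * (c l * lookup (b l) p))   ≡⟨ sym (*-distribˡ-sum a (λ l → c l * lookup (b l) p)) ⟩
    a * sum (λ l → c l * lookup (b l) p)     ≡⟨ cong (a *_) (sym (lookup-lincomb c b p)) ⟩
    a * lookup (lincomb c b) p               ≡⟨ sym (lookup-·ᵛ a (lincomb c b) p) ⟩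
    lookup (a ·ᵛ lincomb c b) p              ∎
    where open ≡-Reasoning

  lincomb-zero : ∀ {n d} (b : Fin d → Vect n) → lincomb (λ _ → 0#) b ≡ 0ᵛ
  lincomb-zero {d = d} b = lookup-ext λ p → begin
    lookup (lincomb (λ _ → 0#) b) p  ≡⟨ lookup-lincomb _ b p ⟩
    sum (λ l → 0# * lookup (b l) p)  ≡⟨ sum-cong-≗ (λ l → zeroˡ (lookup (b l) p)) ⟩
    sum {d} (λ _ → 0#)               ≡⟨ sum-replicate-zero d ⟩
    0#                               ≡⟨ sym (lookup-0ᵛ p) ⟩
    lookup 0ᵛ p                      ∎
    where open ≡-Reasoning

  lincomb-≗0 : ∀ {n d} {β : Fin d → Vect n} {c : Fin d → Carrier} → (∀ l → c l ≡ 0#) → lincomb c β ≡ 0ᵛ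
  lincomb-≗0 {β = β} c≡0 = trans (lincomb-cong c≡0 (λ _ → refl)) (lincomb-zero β)

  lincomb-lincomb : ∀ {n d e} (x : Fin d → Carrier) (B : Fin d → Fin e → Carrier) (u : Fin e → Vect n) →
    lincomb x (λ l → lincomb (B l) u) ≡ lincomb (λ m → sum (λ l → x l * B l m)) u
  lincomb-lincomb x B u = lookup-ext λ p → begin
    lookup (lincomb x (λ l → lincomb (B l) u)) p            ≡⟨ lookup-lincomb x _ p ⟩
    sum (λ l → x l * lookup (lincomb (B l) u) p)            ≡⟨ sum-cong-≗ (λ l → cong (x l *_) (lookup-lincomb (B l) u p)) ⟩
    sum (λ l → x l * sum (λ m → B l m * lookup (u m) p))    ≡⟨ sum-cong-≗ (λ l → *-distribˡ-sum (x l) (λ m → B l m * lookup (u m) p)) ⟩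
    sum (λ l → sum (λ m → x l * (B l m * lookup (u m) p)))  ≡⟨ ∑-comm (λ l m → x l * (B l m * lookup (u m) p)) ⟩
    sum (λ m → sum (λ l → x l * (B l m * lookup (u m) p)))  ≡⟨ sum-cong-≗ (λ m → sum-cong-≗ (λ l → sym (*-assoc (x l) (B l m) _))) ⟩
    sum (λ m → sum (λ l → (x l * B l m) * lookup (u m) p))  ≡⟨ sum-cong-≗ (λ m → sym (*-distribʳ-sum (lookup (u m) p) (λ l → x l * B l m))) ⟩
    sum (λ m → sum (λ l → x l * B l m) * lookup (u m) p)    ≡⟨ sym (lookup-lincomb _ u p) ⟩
    lookup (lincomb (λ m → sum (λ l → x l * B l m)) u) p    ∎
    where open ≡-Reasoning

  sumᵛ-lincomb : ∀ {n d e} (x : Fin d → Fin e → Carrier) (u : Fin e → Vect n) →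
    sumᵛ (λ t → lincomb (x t) u) ≡ lincomb (λ m → sum (λ t → x t m)) u
  sumᵛ-lincomb x u = lookup-ext λ p → begin
    lookup (sumᵛ (λ t → lincomb (x t) u)) p          ≡⟨ lookup-sumᵛ (λ t → lincomb (x t) u) p ⟩
    sum (λ t → lookup (lincomb (x t) u) p)           ≡⟨ sum-cong-≗ (λ t → lookup-lincomb (x t) u p) ⟩
    sum (λ t → sum (λ m → x t m * lookup (u m) p))   ≡⟨ ∑-comm (λ t m → x t m * lookup (u m) p) ⟩
    sum (λ m → sum (λ t → x t m * lookup (u m) p))   ≡⟨ sum-cong-≗ (λ m → sym (*-distribʳ-sum (lookup (u m) p) (λ t → x t m))) ⟩
    sum (λ m → sum (λ t → x t m) * lookup (u m) p)   ≡⟨ sym (lookup-lincomb _ u p) ⟩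
    lookup (lincomb (λ m → sum (λ t → x t m)) u) p   ∎
    where open ≡-Reasoning

  lincomb-++ : ∀ {n a b} (c : Fin (a ℕ.+ b) → Carrier) (u : Fin a → Vect n) (w : Fin b → Vect n) →
    lincomb c (u ++ᶠ w) ≡ lincomb (c ∘ (_↑ˡ b)) u +ᵛ lincomb (c ∘ (a ↑ʳ_)) w
  lincomb-++ {a = a} {b} c u w = trans (sumᵛ-↑ {a = a} (λ l → c l ·ᵛ (u ++ᶠ w) l))
    (cong₂ _+ᵛ_ (sumᵛ-cong (λ l → cong (c (l ↑ˡ b) ·ᵛ_) (lookup-++ˡ u w l)))
                (sumᵛ-cong (λ l → cong (c (a ↑ʳ l) ·ᵛ_) (lookup-++ʳ u w l))))

  x+-1*y≡0⇒x≡y : ∀ {x y} → x + (- 1#) * y ≡ 0# → x ≡ y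
  x+-1*y≡0⇒x≡y {x} {y} eq = begin
    x                   ≡⟨ sym (+-identityʳ x) ⟩
    x + 0#              ≡⟨ cong (x +_) (sym (-‿inverseˡ y)) ⟩
    x + (- y + y)       ≡⟨ sym (+-assoc x (- y) y) ⟩
    (x + - y) + y       ≡⟨ cong (λ z → (x + z) + y) (sym (-1*x≈-x y)) ⟩
    (x + (- 1#) * y) + y ≡⟨ cong (_+ y) eq ⟩
    0# + y              ≡⟨ +-identityˡ y ⟩
    y                   ∎
    where open ≡-Reasoning

  v+ᵛ-1·v≡0 : ∀ {n} (v : Vect n) → v +ᵛ ((- 1#) ·ᵛ v) ≡ 0ᵛ
  v+ᵛ-1·v≡0 v = lookup-ext λ p → begin
    lookup (v +ᵛ ((- 1#) ·ᵛ v)) p             ≡⟨ lookup-+ᵛ v _ p ⟩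
    lookup v p + lookup ((- 1#) ·ᵛ v) p       ≡⟨ cong (lookup v p +_) (lookup-·ᵛ (- 1#) v p) ⟩
    lookup v p + (- 1#) * lookup v p          ≡⟨ cong (lookup v p +_) (-1*x≈-x (lookup v p)) ⟩
    lookup v p + - lookup v p                 ≡⟨ -‿inverseʳ (lookup v p) ⟩
    0#                                        ≡⟨ sym (lookup-0ᵛ p) ⟩
    lookup 0ᵛ p                               ∎
    where open ≡-Reasoning

  LinIndep⇒injective : ∀ {n d} {b : Fin d → Vect n} → LinIndep b →
    ∀ c c′ → lincomb c b ≡ lincomb c′ b → c ≗ c′
  LinIndep⇒injective {b = b} indep c c′ eq l = x+-1*y≡0⇒x≡y (indep (λ l → c l + (- 1#) * c′ l) difference≡0 l)
    where
    difference≡0 : lincomb (λ l → c l + (- 1#) * c′ l) b ≡ 0ᵛ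
    difference≡0 = begin
      lincomb (λ l → c l + (- 1#) * c′ l) b           ≡⟨ lincomb-+ c (λ l → (- 1#) * c′ l) b ⟩
      lincomb c b +ᵛ lincomb (λ l → (- 1#) * c′ l) b  ≡⟨ cong₂ _+ᵛ_ eq (lincomb-· (- 1#) c′ b) ⟩
      lincomb c′ b +ᵛ ((- 1#) ·ᵛ lincomb c′ b)        ≡⟨ v+ᵛ-1·v≡0 (lincomb c′ b) ⟩
      0ᵛ                                              ∎
      where open ≡-Reasoning

  LinIndep-cong : ∀ {n d} {b b′ : Fin d → Vect n} → b ≗ b′ → LinIndep b → LinIndep b′
  LinIndep-cong eq indep c c≡0 = indep c (trans (lincomb-cong (λ _ → refl) eq) c≡0)

  δ : ∀ {d} → Fin d → Fin d → Carrier
  δ zero    zero    = 1#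
  δ zero    (suc _) = 0#
  δ (suc _) zero    = 0#
  δ (suc l) (suc m) = δ l m

  lincomb-δ : ∀ {n d} (b : Fin d → Vect n) l → lincomb (δ l) b ≡ b l
  lincomb-δ {d = suc d} b zero = begin
    (1# ·ᵛ b zero) +ᵛ lincomb (λ _ → 0#) (b ∘ suc) ≡⟨ cong₂ _+ᵛ_ 1·b₀≡b₀ (lincomb-zero (b ∘ suc)) ⟩
    b zero +ᵛ 0ᵛ                                   ≡⟨ +ᵛ-identityʳ (b zero) ⟩
    b zero                                         ∎
    where open ≡-Reasoning
          1·b₀≡b₀ = lookup-ext λ p → trans (lookup-·ᵛ 1# (b zero) p) (*-identityˡ _)
  lincomb-δ {d = suc d} b (suc l) =
    trans (cong₂ _+ᵛ_ (·ᵛ-zeroˡ (b zero)) (lincomb-δ (b ∘ suc) l)) (+ᵛ-identityˡ (b (suc l)))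

  sum-δ : ∀ {d} (c : Fin d → Carrier) m → sum (λ l → c l * δ l m) ≡ c m
  sum-δ {suc d} c zero = begin
    c zero * 1# + sum (λ l → c (suc l) * 0#)  ≡⟨ cong₂ _+_ (*-identityʳ (c zero)) (sum-cong-≗ (λ l → zeroʳ (c (suc l)))) ⟩
    c zero + sum {d} (λ _ → 0#)               ≡⟨ cong (c zero +_) (sum-replicate-zero d) ⟩
    c zero + 0#                               ≡⟨ +-identityʳ (c zero) ⟩
    c zero                                    ∎
    where open ≡-Reasoning
  sum-δ {suc d} c (suc m) = trans (cong₂ _+_ (zeroʳ (c zero)) (sum-δ (c ∘ suc) m)) (+-identityˡ (c (suc m)))

  stdBasis : ∀ {n} → Fin n → Vect n
  stdBasis l = tabulate (δ l)

  lincomb-stdBasis : ∀ {n} (c : Fin n → Carrier) → lincomb c stdBasis ≡ tabulate c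
  lincomb-stdBasis c = lookup-ext λ p → begin
    lookup (lincomb c stdBasis) p               ≡⟨ lookup-lincomb c stdBasis p ⟩
    sum (λ l → c l * lookup (stdBasis l) p)     ≡⟨ sum-cong-≗ (λ l → cong (c l *_) (lookup∘tabulate (δ l) p)) ⟩
    sum (λ l → c l * δ l p)                     ≡⟨ sum-δ c p ⟩
    c p                                         ≡⟨ sym (lookup∘tabulate c p) ⟩
    lookup (tabulate c) p                       ∎
    where open ≡-Reasoning

  stdBasis-indep : ∀ {n} → LinIndep (stdBasis {n})
  stdBasis-indep c c≡0 l = begin
    c l                               ≡⟨ sym (lookup∘tabulate c l) ⟩
    lookup (tabulate c) l             ≡⟨ cong (λ v → lookup v l) (sym (lincomb-stdBasis c)) ⟩
    lookup (lincomb c stdBasis) l     ≡⟨ cong (λ v → lookup v l) c≡0 ⟩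
    lookup 0ᵛ l                       ≡⟨ lookup-0ᵛ l ⟩
    0#                                ∎
    where open ≡-Reasoning

  infixr 25 _⊛_

  _⊛_ : ∀ {n i} → (Fin i → Vect n) → Vect i → Vect n
  u ⊛ x = lincomb (lookup x) u

  ⊛-tabulate : ∀ {n i} (u : Fin i → Vect n) c → u ⊛ tabulate c ≡ lincomb c u
  ⊛-tabulate u c = lincomb-cong (lookup∘tabulate c) (λ _ → refl)

  ⊛-lincomb : ∀ {n i d} (u : Fin i → Vect n) (c : Fin d → Carrier) (B : Fin d → Vect i) →
    u ⊛ lincomb c B ≡ lincomb c (λ l → u ⊛ B l)
  ⊛-lincomb u c B = trans (lincomb-cong (lookup-lincomb c B) (λ _ → refl)) (sym (lincomb-lincomb c (lookup ∘ B) u))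

  ⊛-sumᵛ : ∀ {n i d} (u : Fin i → Vect n) (x : Fin d → Vect i) → u ⊛ sumᵛ x ≡ sumᵛ (λ t → u ⊛ x t)
  ⊛-sumᵛ u x = trans (lincomb-cong (lookup-sumᵛ x) (λ _ → refl)) (sym (sumᵛ-lincomb (lookup ∘ x) u))

  ⊛-0ᵛ : ∀ {n i} (u : Fin i → Vect n) → u ⊛ 0ᵛ ≡ 0ᵛ
  ⊛-0ᵛ {i = i} u = trans (lincomb-cong (lookup-0ᵛ {i}) (λ _ → refl)) (lincomb-zero u)

  ⊛-injective : ∀ {n i} {u : Fin i → Vect n} → LinIndep u → ∀ {x x′} → u ⊛ x ≡ u ⊛ x′ → x ≡ x′
  ⊛-injective indep {x} {x′} eq = lookup-ext (LinIndep⇒injective indep (lookup x) (lookup x′) eq)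

  Vect↔ : ∀ n → Fin (q ^ n) ↔ Vect n
  Vect↔ zero    = mk↔ₛ′ (λ _ → []) (λ _ → zero) (λ { [] → refl }) (λ { zero → refl })
  Vect↔ (suc n) = ↔-trans *↔× (↔-trans (↔-sym enum ×-↔ Vect↔ n) ∷↔)
    where
    ∷↔ : (Carrier × Vect n) ↔ Vect (suc n)
    ∷↔ = mk↔ₛ′ (uncurry _∷_) (λ v → head v , tail v) (λ { (x ∷ v) → refl }) (λ _ → refl)

  InSpan : ∀ {n d} → (Fin d → Vect n) → Vect n → Set
  InSpan b v = ∃[ c ] lincomb c b ≡ v

  inSpan? : ∀ {n d} (b : Fin d → Vect n) → Decidable (InSpan b)
  inSpan? {d = d} b v = map′
    (λ (t , eq) → lookup (to t) , eq)
    (λ (c , eq) → from (tabulate c) , trans (cong (b ⊛_) (strictlyInverseˡ (tabulate c))) (trans (⊛-tabulate b c) eq))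
    (any? (λ t → b ⊛ to t ≟ᵛ v))
    where open Inverse (Vect↔ d)

  InSpan⇒⊛ : ∀ {n d} {b : Fin d → Vect n} {v} → InSpan b v → ∃ λ x → b ⊛ x ≡ v
  InSpan⇒⊛ {b = b} (c , eq) = tabulate c , trans (⊛-tabulate b c) eq

  InSpan-≗ : ∀ {n d} {b b′ : Fin d → Vect n} {v} → b ≗ b′ → InSpan b v → InSpan b′ v
  InSpan-≗ eq (c , c≡v) = c , trans (lincomb-cong (λ _ → refl) (sym ∘ eq)) c≡v

  InSpan-⊛ : ∀ {n d} (b : Fin d → Vect n) x → InSpan b (b ⊛ x)
  InSpan-⊛ b x = lookup x , refl

  InSpan-lincomb : ∀ {n d e} {β : Fin d → Vect n} {u : Fin e → Vect n} → (∀ l → InSpan β (u l)) → ∀ x → InSpan β (lincomb x u)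
  InSpan-lincomb {β = β} {u} u⊆β x =
    _ , trans (sym (lincomb-lincomb x (proj₁ ∘ u⊆β) β)) (lincomb-cong (λ _ → refl) (proj₂ ∘ u⊆β))

  InSpan-sumᵛ : ∀ {n d e} {u : Fin d → Vect n} (w : Fin e → Vect n) → (∀ l → InSpan u (w l)) → InSpan u (sumᵛ w)
  InSpan-sumᵛ {u = u} w w⊆u =
    _ , trans (sym (sumᵛ-lincomb (proj₁ ∘ w⊆u) u)) (sumᵛ-cong (proj₂ ∘ w⊆u))

  InSpan-stdBasis : ∀ {n} (v : Vect n) → InSpan stdBasis v
  InSpan-stdBasis v = lookup v , trans (lincomb-stdBasis (lookup v)) (tabulate∘lookup v)

  Span : ∀ {n d} → (Fin d → Vect n) → Set
  Span {n} β = Σ (Vect n) (InSpan β)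

  Span-card : ∀ {n d} {β : Fin d → Vect n} → LinIndep β → HasCard {Span β} (_≡_ on proj₁) (q ^ d)
  Span-card {d = d} {β} indep =
    HasCard-map {R = _≡_} {S = _≡_ on proj₁} (λ x → β ⊛ x , InSpan-⊛ β x) (cong (β ⊛_)) (⊛-injective indep) surj trans
      (HasCard-≡ (Vect↔ d))
    where
    surj : (v : Span β) → ∃ λ x → β ⊛ x ≡ proj₁ v
    surj (_ , v∈β) = InSpan⇒⊛ v∈β

  module _ {n d e} {β : Fin d → Vect n} {u : Fin e → Vect n} (β-indep : LinIndep β)
           (u⊆β : ∀ l → InSpan β (u l)) (u-indep : LinIndep u) where

    private
      InSpanᵘ : Span β → Set
      InSpanᵘ = InSpan u ∘ proj₁

      InSpanᵘ-resp : ∀ {a b : Span β} → proj₁ a ≡ proj₁ b → InSpanᵘ b → InSpanᵘ a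
      InSpanᵘ-resp eq = subst (InSpan u) (sym eq)

      inside : HasCard {Σ (Span β) InSpanᵘ} (_≡_ on (proj₁ ∘ proj₁)) (q ^ e)
      inside = HasCard-map {R = _≡_} {S = _≡_ on (proj₁ ∘ proj₁)} (λ x → (u ⊛ x , InSpan-lincomb u⊆β (lookup x)) , InSpan-⊛ u x)
        (cong (u ⊛_)) (⊛-injective u-indep) surj trans (HasCard-≡ (Vect↔ e))
        where
        surj : (v : Σ (Span β) InSpanᵘ) → ∃ λ x → u ⊛ x ≡ proj₁ (proj₁ v)
        surj (_ , v∈u) = InSpan⇒⊛ v∈u

    Span∖Span-card : HasCard {Σ (Span β) (¬_ ∘ InSpanᵘ)} (_≡_ on (proj₁ ∘ proj₁)) (q ^ d ∸ q ^ e)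
    Span∖Span-card = subst (HasCard {Σ (Span β) (¬_ ∘ InSpanᵘ)} (_≡_ on (proj₁ ∘ proj₁))) outside≡ outside
      where
      P? : Decidable InSpanᵘ
      P? = inSpan? u ∘ proj₁
      whole = Span-card β-indep
      outside = HasCard-filter whole (λ a → ¬? (P? a)) (λ eq ¬p p → ¬p (subst (InSpan u) eq p))
      inside≡ : count (P? ∘ proj₁ whole) ≡ q ^ e
      inside≡ = HasCard-unique {R = _≡_ on (proj₁ ∘ proj₁)} sym trans
        (HasCard-filter whole P? (λ {a} {b} → InSpanᵘ-resp {a} {b})) inside
      outside≡ : count (λ l → ¬? (P? (proj₁ whole l))) ≡ q ^ d ∸ q ^ e
      outside≡ = trans (sym (ℕ.m+n∸m≡n (count (P? ∘ proj₁ whole)) _)) (cong₂ _∸_ (count+count-∁ (P? ∘ proj₁ whole)) inside≡)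

  lincomb-0◂ : ∀ {n d} (c : Fin d → Carrier) (u : Fin (suc d) → Vect n) → lincomb (0# ◂ c) u ≡ lincomb c (u ∘ suc)
  lincomb-0◂ c u = trans (cong (_+ᵛ lincomb c (u ∘ suc)) (·ᵛ-zeroˡ (u zero))) (+ᵛ-identityˡ _)

  LinIndep-tail : ∀ {n d} {u : Fin (suc d) → Vect n} → LinIndep u → LinIndep (u ∘ suc)
  LinIndep-tail {u = u} indep c c≡0 l = indep (0# ◂ c) (trans (lincomb-0◂ c u) c≡0) (suc l)

  head∉span-tail : ∀ {n d} {u : Fin (suc d) → Vect n} → LinIndep u → ¬ InSpan (u ∘ suc) (u zero)
  head∉span-tail {u = u} indep (c , eq) =
    0≢1 (LinIndep⇒injective {b = u} indep (0# ◂ c) (δ zero) (trans (lincomb-0◂ c u) (trans eq (sym (lincomb-δ u zero)))) zero)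

  c·v+w≡0⇒-c⁻¹·w≡v : ∀ {n c c⁻¹} {v w : Vect n} → c * c⁻¹ ≡ 1# → (c ·ᵛ v) +ᵛ w ≡ 0ᵛ → (- c⁻¹) ·ᵛ w ≡ v
  c·v+w≡0⇒-c⁻¹·w≡v {c = c} {c⁻¹} {v} {w} cc⁻¹≡1 eq = lookup-ext λ p → begin
    lookup ((- c⁻¹) ·ᵛ w) p   ≡⟨ lookup-·ᵛ (- c⁻¹) w p ⟩
    (- c⁻¹) * lookup w p      ≡⟨ c*x+z≡0⇒-c⁻¹*z≡x cc⁻¹≡1 (begin
      c * lookup v p + lookup w p      ≡⟨ cong (_+ lookup w p) (lookup-·ᵛ c v p) ⟨
      lookup (c ·ᵛ v) p + lookup w p   ≡⟨ lookup-+ᵛ (c ·ᵛ v) w p ⟨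
      lookup ((c ·ᵛ v) +ᵛ w) p         ≡⟨ cong (λ z → lookup z p) eq ⟩
      lookup 0ᵛ p                      ≡⟨ lookup-0ᵛ p ⟩
      0#                               ∎) ⟩
    lookup v p                ∎
    where open ≡-Reasoning

  LinIndep-◂ : ∀ {n d} {u : Fin d → Vect n} {v} → LinIndep u → ¬ InSpan u v → LinIndep (v ◂ u)
  LinIndep-◂ {u = u} {v} indep v∉u c c≡0 with c zero ≟ᶜ 0#
  ... | yes c₀≡0 = λ { zero → c₀≡0 ; (suc l) → indep (c ∘ suc) tail≡0 l }
    where
    tail≡0 : lincomb (c ∘ suc) u ≡ 0ᵛ
    tail≡0 = trans (sym (lincomb-0◂ (c ∘ suc) (v ◂ u)))
      (trans (lincomb-cong {c = 0# ◂ (c ∘ suc)} {c} {v ◂ u} (λ { zero → sym c₀≡0 ; (suc _) → refl }) (λ _ → refl)) c≡0)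
  ... | no c₀≢0 = contradiction (_ , trans (lincomb-· (- c₀⁻¹) (c ∘ suc) u) (c·v+w≡0⇒-c⁻¹·w≡v c₀c₀⁻¹≡1 c≡0)) v∉u
    where
    c₀⁻¹ = proj₁ (inverse (c zero) c₀≢0)
    c₀c₀⁻¹≡1 = proj₂ (inverse (c zero) c₀≢0)

  IndepIn : ∀ {n i} → (Fin i → Vect n) → ℕ → Set
  IndepIn {n} β d = Σ (Fin d → Vect n) (λ u → (∀ l → InSpan β (u l)) × LinIndep u)

  IndepIn-card : ∀ {n i} {β : Fin i → Vect n} → LinIndep β →
    ∀ d → HasCard {IndepIn β d} (_≗_ on proj₁) (prodBelow d (λ l → q ^ i ∸ q ^ l))
  IndepIn-card β-indep zero = (λ _ → (λ ()) , (λ ()) , (λ _ _ ())) , (λ _ → zero , λ ()) , λ { zero zero _ → refl }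
  IndepIn-card {n} {i} {β} β-indep (suc d) =
    HasCard-map {R = Rext} {S = _≗_ on proj₁} extend
      (λ (eq , eqv) → λ { zero → eqv ; (suc l) → eq l }) (λ eq → eq ∘ suc , eq zero) surj
      (λ eq eq′ l → trans (eq l) (eq′ l))
      (HasCard-Σ {S = _≡_ on proj₁} Outside (λ eq v∉ v∈ → v∉ (InSpan-≗ eq v∈))
        (IndepIn-card β-indep d) (λ (u , u⊆β , u-indep) → Span∖Span-card β-indep u⊆β u-indep))
    where
    Outside : IndepIn β d → Span β → Set
    Outside u v = ¬ InSpan (proj₁ u) (proj₁ v)
    Rext = λ (x y : Σ (IndepIn β d) (λ u → Σ (Span β) (Outside u))) →
      proj₁ (proj₁ x) ≗ proj₁ (proj₁ y) × proj₁ (proj₁ (proj₂ x)) ≡ proj₁ (proj₁ (proj₂ y))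
    extend : Σ (IndepIn β d) (λ u → Σ (Span β) (Outside u)) → IndepIn β (suc d)
    extend ((u , u⊆β , u-indep) , (v , v∈β) , v∉u) =
      v ◂ u , (λ { zero → v∈β ; (suc l) → u⊆β l }) , LinIndep-◂ u-indep v∉u
    surj : ∀ w → ∃ λ x → proj₁ (extend x) ≗ proj₁ w
    surj (u , u⊆β , u-indep) =
      ((u ∘ suc , u⊆β ∘ suc , LinIndep-tail {u = u} u-indep) , (u zero , u⊆β zero) , head∉span-tail {u = u} u-indep) ,
      λ { zero → refl ; (suc l) → refl }

  indep-of-full-length-spans : ∀ {n a b} {β : Fin a → Vect n} {u : Fin b → Vect n} → LinIndep β → a ≡ b →
    (∀ l → InSpan β (u l)) → LinIndep u → ∀ {v} → InSpan β v → InSpan u v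
  indep-of-full-length-spans {a = a} {β = β} {u} β-indep refl u⊆β u-indep {v} v∈β with inSpan? u v
  ... | yes v∈u = v∈u
  ... | no  v∉u = ⊥-elim (HasCard-0⇒¬ {R = _≡_ on (proj₁ ∘ proj₁)} nothing-outside ((v , v∈β) , v∉u))
    where
    nothing-outside = subst (HasCard {Σ (Span β) (¬_ ∘ InSpan u ∘ proj₁)} (_≡_ on (proj₁ ∘ proj₁)))
                            (ℕ.n∸n≡0 (q ^ a)) (Span∖Span-card β-indep u⊆β u-indep)

  q^-injective : ∀ {a b} → q ^ a ≡ q ^ b → a ≡ b
  q^-injective {a} {b} eq = let (r , q≡2+r) = q≥2 K in 2+r^-injective r (subst (λ x → x ^ a ≡ x ^ b) q≡2+r eq)

  same-span⇒same-length : ∀ {n a b} {β : Fin a → Vect n} {β′ : Fin b → Vect n} → LinIndep β → LinIndep β′ →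
    (∀ {v} → InSpan β v → InSpan β′ v) → (∀ {v} → InSpan β′ v → InSpan β v) → a ≡ b
  same-span⇒same-length {β = β} {β′} β-indep β′-indep β⊆β′ β′⊆β =
    q^-injective (HasCard-unique {R = _≡_ on proj₁} sym trans span-β-in-β′ (Span-card β′-indep))
    where
    span-β-in-β′ = HasCard-map {R = _≡_ on proj₁} {S = _≡_ on proj₁} (λ (v , v∈β) → v , β⊆β′ v∈β)
      (λ eq → eq) (λ eq → eq) (λ (v , v∈β′) → (v , β′⊆β v∈β′) , refl) trans (Span-card β-indep)

  lincomb-++-++ : ∀ {n a b} (c₁ : Fin a → Carrier) (c₂ : Fin b → Carrier) (u : Fin a → Vect n) (w : Fin b → Vect n) →
    lincomb (c₁ ++ᶠ c₂) (u ++ᶠ w) ≡ lincomb c₁ u +ᵛ lincomb c₂ w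
  lincomb-++-++ c₁ c₂ u w = trans (lincomb-++ (c₁ ++ᶠ c₂) u w)
    (cong₂ _+ᵛ_ (lincomb-cong (lookup-++ˡ c₁ c₂) (λ _ → refl)) (lincomb-cong (lookup-++ʳ c₁ c₂) (λ _ → refl)))

  module _ {n a b} {u : Fin a → Vect n} {w : Fin b → Vect n} where

    LinIndep-++⁻ : LinIndep (u ++ᶠ w) → ∀ c₁ c₂ → lincomb c₁ u +ᵛ lincomb c₂ w ≡ 0ᵛ →
      (∀ l → c₁ l ≡ 0#) × (∀ l → c₂ l ≡ 0#)
    LinIndep-++⁻ indep c₁ c₂ eq =
      (λ l → trans (sym (lookup-++ˡ c₁ c₂ l)) (all≡0 (l ↑ˡ b))) ,
      (λ l → trans (sym (lookup-++ʳ c₁ c₂ l)) (all≡0 (a ↑ʳ l)))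
      where all≡0 = indep (c₁ ++ᶠ c₂) (trans (lincomb-++-++ c₁ c₂ u w) eq)

    LinIndep-++-injective : LinIndep (u ++ᶠ w) → ∀ c₁ c₂ c₁′ c₂′ →
      lincomb c₁ u +ᵛ lincomb c₂ w ≡ lincomb c₁′ u +ᵛ lincomb c₂′ w → c₁ ≗ c₁′ × c₂ ≗ c₂′
    LinIndep-++-injective indep c₁ c₂ c₁′ c₂′ eq =
      (λ l → trans (sym (lookup-++ˡ c₁ c₂ l)) (trans (same (l ↑ˡ b)) (lookup-++ˡ c₁′ c₂′ l))) ,
      (λ l → trans (sym (lookup-++ʳ c₁ c₂ l)) (trans (same (a ↑ʳ l)) (lookup-++ʳ c₁′ c₂′ l)))
      where same = LinIndep⇒injective indep (c₁ ++ᶠ c₂) (c₁′ ++ᶠ c₂′)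
                     (trans (lincomb-++-++ c₁ c₂ u w) (trans eq (sym (lincomb-++-++ c₁′ c₂′ u w))))

    LinIndep-++⁻ˡ : LinIndep (u ++ᶠ w) → LinIndep u
    LinIndep-++⁻ˡ indep c eq =
      proj₁ (LinIndep-++⁻ indep c (λ _ → 0#) (trans (cong₂ _+ᵛ_ eq (lincomb-zero w)) (+ᵛ-identityˡ 0ᵛ)))

    LinIndep-++⁻ʳ : LinIndep (u ++ᶠ w) → LinIndep w
    LinIndep-++⁻ʳ indep c eq =
      proj₂ (LinIndep-++⁻ indep (λ _ → 0#) c (trans (cong₂ _+ᵛ_ (lincomb-zero u) eq) (+ᵛ-identityˡ 0ᵛ)))

    LinIndep-++-swap : LinIndep (u ++ᶠ w) → LinIndep (w ++ᶠ u)
    LinIndep-++-swap indep c eq = ↑-elim (proj₂ halves≡0) (proj₁ halves≡0)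
      where halves≡0 = LinIndep-++⁻ indep (c ∘ (b ↑ʳ_)) (c ∘ (_↑ˡ a))
                         (trans (+ᵛ-comm _ _) (trans (sym (lincomb-++ c w u)) eq))

    LinIndep-++ : LinIndep u → LinIndep w →
      (∀ c₁ c₂ → lincomb c₁ u +ᵛ lincomb c₂ w ≡ 0ᵛ → lincomb c₁ u ≡ 0ᵛ) → LinIndep (u ++ᶠ w)
    LinIndep-++ u-indep w-indep disjoint c eq = ↑-elim (u-indep c₁ c₁u≡0) (w-indep c₂ c₂w≡0)
      where
      c₁ = c ∘ (_↑ˡ b)
      c₂ = c ∘ (a ↑ʳ_)
      sum≡0 = trans (sym (lincomb-++ c u w)) eq
      c₁u≡0 = disjoint c₁ c₂ sum≡0
      c₂w≡0 = trans (sym (+ᵛ-identityˡ _)) (trans (cong (_+ᵛ lincomb c₂ w) (sym c₁u≡0)) sum≡0)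

  lincomb-concatᶠ : ∀ {n k} (d : Fin k → ℕ) (b : (l : Fin k) → Fin (d l) → Vect n) (c : Fin (∑ℕ d) → Carrier) →
    lincomb c (concatᶠ d b) ≡ sumᵛ (λ l → lincomb (block d c l) (b l))
  lincomb-concatᶠ {k = zero}  d b c = refl
  lincomb-concatᶠ {k = suc k} d b c = trans (lincomb-++ c (b zero) (concatᶠ (d ∘ suc) (b ∘ suc)))
    (cong (lincomb (c ∘ (_↑ˡ _)) (b zero) +ᵛ_) (lincomb-concatᶠ (d ∘ suc) (b ∘ suc) (c ∘ (d zero ↑ʳ_))))

  sumᵛ-↔ : ∀ {n k a b} (ρ : Fin k ↔ (Fin a ⊎ Fin b)) (z : Fin k → Vect n) →
    sumᵛ z ≡ sumᵛ (z ∘ Inverse.from ρ ∘ inj₁) +ᵛ sumᵛ (z ∘ Inverse.from ρ ∘ inj₂)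
  sumᵛ-↔ {n} {a = a} {b} ρ z = begin
    sumᵛ z                                        ≡⟨ sumᵛ≡∑ᵛ z ⟩
    ∑ᵛ.sum n z                                    ≡⟨ ∑ᵛ.sum-permute n z (↔-trans +↔⊎ (↔-sym ρ)) ⟩
    ∑ᵛ.sum n z′                                   ≡⟨ sym (sumᵛ≡∑ᵛ z′) ⟩
    sumᵛ z′                                       ≡⟨ sumᵛ-↑ {a = a} z′ ⟩
    sumᵛ (z′ ∘ (_↑ˡ b)) +ᵛ sumᵛ (z′ ∘ (a ↑ʳ_))    ≡⟨ cong₂ _+ᵛ_ (sumᵛ-cong (λ t → cong (z ∘ from ρ) (splitAt-↑ˡ a t b)))
                                                                (sumᵛ-cong (λ t → cong (z ∘ from ρ) (splitAt-↑ʳ a b t))) ⟩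
    sumᵛ (z ∘ from ρ ∘ inj₁) +ᵛ sumᵛ (z ∘ from ρ ∘ inj₂) ∎
    where
    open ≡-Reasoning
    open Inverse using (from)
    z′ = z ∘ from ρ ∘ splitAt a

module Decompositions (K : FiniteField) where
  open FiniteField K
  open LinAlg K
  open Linear K

  Within : ∀ {n d} → Subset n → (Fin d → Vect n) → Set
  Within V u = ∀ {v} → T (V v) → InSpan u v

  Decomposes : ∀ {n k} → (Fin k → Subset n) → (Vect n → Set) → Set
  Decomposes {n} {k} V S =
      (∀ {v} → S v → Σ[ w ∈ (Fin k → Vect n) ] (∀ l → T (V l (w l))) × sumᵛ w ≡ v)
    × (∀ (w : Fin k → Vect n) → (∀ l → T (V l (w l))) → sumᵛ w ≡ 0ᵛ → ∀ l → w l ≡ 0ᵛ)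

  Decomposes⇒DirectSumDecomp : ∀ {n k} {V : Fin k → Subset n} {S} → Decomposes V S → (∀ v → S v) → DirectSumDecomp V
  Decomposes⇒DirectSumDecomp (decompose , unique) all-S = (λ v → decompose (all-S v)) , unique

  Decomposes-cong : ∀ {n k} {V V′ : Fin k → Subset n} {S} → (∀ l → V l ≡ V′ l) → Decomposes V S → Decomposes V′ S
  Decomposes-cong V≡V′ (decompose , unique) =
    (λ v∈S → let (w , w∈V , Σw≡v) = decompose v∈S in w , (λ l → subst (λ V → T (V (w l))) (V≡V′ l) (w∈V l)) , Σw≡v) ,
    (λ w w∈V′ → unique w (λ l → subst (λ V → T (V (w l))) (sym (V≡V′ l)) (w∈V′ l)))

  Decomposes-++ : ∀ {n a b k k′} {u : Fin a → Vect n} {w : Fin b → Vect n} {V : Fin k → Subset n} {V′ : Fin k′ → Subset n} →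
    LinIndep (u ++ᶠ w) → (∀ l → Within (V l) u) → (∀ l → Within (V′ l) w) →
    Decomposes V (InSpan u) → Decomposes V′ (InSpan w) → Decomposes (V ++ᶠ V′) (InSpan (u ++ᶠ w))
  Decomposes-++ {n} {a} {b} {k} {k′} {u} {w} {V} {V′} indep V⊆u V′⊆w (split , unique) (split′ , unique′) =
    decompose , unique-++
    where
    decompose : ∀ {v} → InSpan (u ++ᶠ w) v → _
    decompose (c , refl) =
      let (x , x∈V , Σx) = split (c ∘ (_↑ˡ b) , refl)
          (y , y∈V′ , Σy) = split′ (c ∘ (a ↑ʳ_) , refl)
      in x ++ᶠ y ,
         ↑-elim (λ l → subst₂ (λ V z → T (V z)) (sym (lookup-++ˡ V V′ l)) (sym (lookup-++ˡ x y l)) (x∈V l))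
                (λ l → subst₂ (λ V z → T (V z)) (sym (lookup-++ʳ V V′ l)) (sym (lookup-++ʳ x y l)) (y∈V′ l)) ,
         trans (sumᵛ-↑ {a = k} (x ++ᶠ y))
           (trans (cong₂ _+ᵛ_ (trans (sumᵛ-cong (lookup-++ˡ x y)) Σx) (trans (sumᵛ-cong (lookup-++ʳ x y)) Σy))
                  (sym (lincomb-++ c u w)))
    unique-++ : ∀ z → (∀ l → T ((V ++ᶠ V′) l (z l))) → sumᵛ z ≡ 0ᵛ → ∀ l → z l ≡ 0ᵛ
    unique-++ z z∈ Σz≡0 =
      ↑-elim (unique (z ∘ (_↑ˡ k′)) z∈V (trans (sym (proj₂ x-coords)) (lincomb-≗0 x≡0)))
             (unique′ (z ∘ (k ↑ʳ_)) z∈V′ (trans (sym (proj₂ y-coords)) (lincomb-≗0 y≡0)))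
      where
      z∈V : ∀ l → T (V l (z (l ↑ˡ k′)))
      z∈V l = subst (λ V → T (V (z (l ↑ˡ k′)))) (lookup-++ˡ V V′ l) (z∈ (l ↑ˡ k′))
      z∈V′ : ∀ l → T (V′ l (z (k ↑ʳ l)))
      z∈V′ l = subst (λ V → T (V (z (k ↑ʳ l)))) (lookup-++ʳ V V′ l) (z∈ (k ↑ʳ l))
      x-coords = InSpan-sumᵛ (z ∘ (_↑ˡ k′)) (λ l → V⊆u l (z∈V l))
      y-coords = InSpan-sumᵛ (z ∘ (k ↑ʳ_)) (λ l → V′⊆w l (z∈V′ l))
      halves≡0 = LinIndep-++⁻ indep (proj₁ x-coords) (proj₁ y-coords)
        (trans (cong₂ _+ᵛ_ (proj₂ x-coords) (proj₂ y-coords)) (trans (sym (sumᵛ-↑ {a = k} z)) Σz≡0))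
      x≡0 = proj₁ halves≡0
      y≡0 = proj₂ halves≡0

  Image : ∀ {n i} → (Fin i → Vect n) → Subset i → Vect n → Set
  Image u L v = ∃ λ x → u ⊛ x ≡ v × T (L x)

  image? : ∀ {n i} (u : Fin i → Vect n) (L : Subset i) → Decidable (Image u L)
  image? {i = i} u L v = map′
    (λ (t , eq , x∈L) → to t , eq , x∈L)
    (λ (x , eq , x∈L) → from x , subst (λ y → u ⊛ y ≡ v × T (L y)) (sym (strictlyInverseˡ x)) (eq , x∈L))
    (any? (λ t → (u ⊛ to t ≟ᵛ v) ×-dec T? (L (to t))))
    where open Inverse (Vect↔ i)

  -- Opaque: otherwise unifying two relabelled cards unfolds the search in image?.
  opaque
    image : ∀ {n i} → (Fin i → Vect n) → Subset i → Subset n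
    image u L v = isYes (image? u L v)

  opaque
    unfolding image

    image⇒Image : ∀ {n i} {u : Fin i → Vect n} {L v} → T (image u L v) → Image u L v
    image⇒Image = toWitness

    Image⇒image : ∀ {n i} {u : Fin i → Vect n} {L v} → Image u L v → T (image u L v)
    Image⇒image = fromWitness

  preimage : ∀ {n i} → (Fin i → Vect n) → Subset n → Subset i
  preimage u V x = V (u ⊛ x)

  module _ {n i} {u : Fin i → Vect n} where

    ∈-image : ∀ {L x} → T (L x) → T (image u L (u ⊛ x))
    ∈-image {x = x} x∈L = Image⇒image (x , refl , x∈L)

    image-Within : ∀ L → Within (image u L) u
    image-Within L v∈ = let (x , eq , _) = image⇒Image v∈ in lookup x , eq

    ∈-image⁻¹ : LinIndep u → ∀ {L x} → T (image u L (u ⊛ x)) → T (L x)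
    ∈-image⁻¹ indep {L} x∈ = let (y , eq , y∈L) = image⇒Image x∈ in subst (T ∘ L) (⊛-injective indep eq) y∈L

    image-preimage : ∀ {V} → Within V u → ∀ {v} → T (V v) → T (image u (preimage u V) v)
    image-preimage {V} V⊆u v∈V = let (c , eq) = V⊆u v∈V in
      Image⇒image (tabulate c , trans (⊛-tabulate u c) eq , subst (T ∘ V) (sym (trans (⊛-tabulate u c) eq)) v∈V)

    image-preimage⁻¹ : ∀ {V v} → T (image u (preimage u V) v) → T (V v)
    image-preimage⁻¹ {V} v∈ = let (x , eq , x∈) = image⇒Image v∈ in subst (T ∘ V) eq x∈

    opaque
      HasDim-image : LinIndep u → ∀ {L d} → HasDim L d → HasDim (image u L) d
      HasDim-image indep {L} (b , b-indep , b-spans) = (λ l → u ⊛ b l) , indep′ , spans′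
        where
        indep′ : LinIndep (λ l → u ⊛ b l)
        indep′ c eq = b-indep c (⊛-injective indep (trans (⊛-lincomb u c b) (trans eq (sym (⊛-0ᵛ u)))))
        spans′ : ∀ v → (T (image u L v) → InSpan (λ l → u ⊛ b l) v) × (InSpan (λ l → u ⊛ b l) v → T (image u L v))
        spans′ v = (λ v∈ → let (x , eq , x∈L) = image⇒Image v∈ ; (c , eq′) = proj₁ (b-spans x) x∈L in
                             c , trans (sym (⊛-lincomb u c b)) (trans (cong (u ⊛_) eq′) eq)) ,
                   (λ (c , eq) → subst (T ∘ image u L) (trans (⊛-lincomb u c b) eq) (∈-image (proj₂ (b-spans _) (c , refl))))

      HasDim-preimage : LinIndep u → ∀ {V d} → Within V u → HasDim V d → HasDim (preimage u V) d
      HasDim-preimage indep {V} {d} V⊆u (b , b-indep , b-spans) = coords , indep′ , spans′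
        where
        coords : Fin d → Vect i
        coords l = tabulate (proj₁ (V⊆u (proj₂ (b-spans (b l)) (δ l , lincomb-δ b l))))
        u⊛coords : ∀ l → u ⊛ coords l ≡ b l
        u⊛coords l = let (c , eq) = V⊆u (proj₂ (b-spans (b l)) (δ l , lincomb-δ b l)) in trans (⊛-tabulate u c) eq
        u⊛lincomb : ∀ c → u ⊛ lincomb c coords ≡ lincomb c b
        u⊛lincomb c = trans (⊛-lincomb u c coords) (lincomb-cong (λ _ → refl) u⊛coords)
        indep′ : LinIndep coords
        indep′ c eq = b-indep c (trans (sym (u⊛lincomb c)) (trans (cong (u ⊛_) eq) (⊛-0ᵛ u)))
        spans′ : ∀ x → (T (V (u ⊛ x)) → InSpan coords x) × (InSpan coords x → T (V (u ⊛ x)))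
        spans′ x = (λ ux∈V → let (c , eq) = proj₁ (b-spans (u ⊛ x)) ux∈V in c , ⊛-injective indep (trans (u⊛lincomb c) eq)) ,
                   (λ (c , eq) → subst (T ∘ V) (trans (sym (u⊛lincomb c)) (cong (u ⊛_) eq)) (proj₂ (b-spans _) (c , refl)))

    Decomposes-image : LinIndep u → ∀ {k} {L : Fin k → Subset i} → DirectSumDecomp L →
      Decomposes (λ l → image u (L l)) (InSpan u)
    Decomposes-image indep {k} {L} (split , unique) = decompose , unique′
      where
      decompose : ∀ {v} → InSpan u v → _
      decompose v∈u =
        let (x , ux≡v) = InSpan⇒⊛ v∈u
            (y , y∈L , Σy≡x) = split x
        in (λ l → u ⊛ y l) , (λ l → ∈-image (y∈L l)) ,
           trans (sym (⊛-sumᵛ u y)) (trans (cong (u ⊛_) Σy≡x) ux≡v)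
      unique′ : ∀ z → (∀ l → T (image u (L l) (z l))) → sumᵛ z ≡ 0ᵛ → ∀ l → z l ≡ 0ᵛ
      unique′ z z∈ Σz≡0 l = trans (sym (proj₁ (proj₂ (y l)))) (trans (cong (u ⊛_) (y≡0 l)) (⊛-0ᵛ u))
        where
        y = λ l → image⇒Image (z∈ l)
        Σy≡0 : sumᵛ (λ l → proj₁ (y l)) ≡ 0ᵛ
        Σy≡0 = ⊛-injective indep (trans (⊛-sumᵛ u (λ l → proj₁ (y l)))
                 (trans (sumᵛ-cong (λ l → proj₁ (proj₂ (y l)))) (trans Σz≡0 (sym (⊛-0ᵛ u)))))
        y≡0 = unique (λ l → proj₁ (y l)) (λ l → proj₂ (proj₂ (y l))) Σy≡0

    Decomposes-preimage : LinIndep u → ∀ {k} {V : Fin k → Subset n} → (∀ l → Within (V l) u) →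
      Decomposes V (InSpan u) → DirectSumDecomp (λ l → preimage u (V l))
    Decomposes-preimage indep {k} {V} V⊆u (decompose , unique) = split , unique′
      where
      split : ∀ x → _
      split x =
        let (w , w∈V , Σw≡ux) = decompose (InSpan-⊛ u x)
            y = λ l → proj₁ (InSpan⇒⊛ (V⊆u l (w∈V l)))
            uy≡w = λ l → proj₂ (InSpan⇒⊛ (V⊆u l (w∈V l)))
        in y , (λ l → subst (T ∘ V l) (sym (uy≡w l)) (w∈V l)) ,
           ⊛-injective indep (trans (⊛-sumᵛ u y) (trans (sumᵛ-cong uy≡w) Σw≡ux))
      unique′ : ∀ y → (∀ l → T (V l (u ⊛ y l))) → sumᵛ y ≡ 0ᵛ → ∀ l → y l ≡ 0ᵛ
      unique′ y y∈ Σy≡0 l = ⊛-injective indep (trans (uy≡0 l) (sym (⊛-0ᵛ u)))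
        where uy≡0 = unique (λ l → u ⊛ y l) y∈ (trans (sym (⊛-sumᵛ u y)) (trans (cong (u ⊛_) Σy≡0) (⊛-0ᵛ u)))

  Decomposes-select : ∀ {n k a b i i₂} {V : Fin k → Subset n} {u : Fin i → Vect n} {w : Fin i₂ → Vect n} →
    (∀ l → T (V l 0ᵛ)) → DirectSumDecomp V → (ρ : Fin k ↔ (Fin a ⊎ Fin b)) → LinIndep (u ++ᶠ w) →
    (∀ t → Within (V (Inverse.from ρ (inj₁ t))) u) → (∀ t → Within (V (Inverse.from ρ (inj₂ t))) w) →
    Decomposes (V ∘ Inverse.from ρ ∘ inj₁) (InSpan u)
  Decomposes-select {n} {V = V} {u} {w} 0∈V (split , unique) ρ indep V₁⊆u V₂⊆w = decompose , unique′
    where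
    open Inverse ρ
    decompose : ∀ {v} → InSpan u v → _
    decompose {v} (c , refl) =
      z ∘ from ∘ inj₁ , z∈V ∘ from ∘ inj₁ , trans (sym c₁u≡) (lincomb-cong {b = u} coords≡ (λ _ → refl))
      where
      open Σ (split v) renaming (proj₁ to z; proj₂ to z-prop)
      z∈V = proj₁ z-prop
      c₁u = InSpan-sumᵛ (z ∘ from ∘ inj₁) (λ t → V₁⊆u t (z∈V _))
      c₂w = InSpan-sumᵛ (z ∘ from ∘ inj₂) (λ t → V₂⊆w t (z∈V _))
      c₁u≡ = proj₂ c₁u
      sum≡ : lincomb (proj₁ c₁u) u +ᵛ lincomb (proj₁ c₂w) w ≡ lincomb c u +ᵛ lincomb (λ _ → 0#) w
      sum≡ = trans (cong₂ _+ᵛ_ c₁u≡ (proj₂ c₂w))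
        (trans (sym (sumᵛ-↔ ρ z)) (trans (proj₂ z-prop)
          (sym (trans (cong (lincomb c u +ᵛ_) (lincomb-zero w)) (+ᵛ-identityʳ _)))))
      coords≡ = proj₁ (LinIndep-++-injective indep (proj₁ c₁u) (proj₁ c₂w) c (λ _ → 0#) sum≡)
    unique′ : ∀ z → (∀ t → T (V (from (inj₁ t)) (z t))) → sumᵛ z ≡ 0ᵛ → ∀ t → z t ≡ 0ᵛ
    unique′ z z∈ Σz≡0 t = trans (cong ([ z , (λ _ → 0ᵛ) ]′) (sym (strictlyInverseˡ (inj₁ t)))) (ẑ≡0 (from (inj₁ t)))
      where
      ẑ : Fin _ → Vect n
      ẑ l = [ z , (λ _ → 0ᵛ) ]′ (to l)
      ẑ∈V : ∀ l → T (V l (ẑ l))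
      ẑ∈V l with to l in eq
      ... | inj₁ t = subst (λ l → T (V l (z t))) (trans (cong from (sym eq)) (strictlyInverseʳ l)) (z∈ t)
      ... | inj₂ _ = 0∈V l
      Σẑ≡0 : sumᵛ ẑ ≡ 0ᵛ
      Σẑ≡0 = begin
        sumᵛ ẑ                                                   ≡⟨ sumᵛ-↔ ρ ẑ ⟩
        sumᵛ (ẑ ∘ from ∘ inj₁) +ᵛ sumᵛ (ẑ ∘ from ∘ inj₂)
          ≡⟨ cong₂ _+ᵛ_ (sumᵛ-cong (λ t → cong [ z , (λ _ → 0ᵛ) ]′ (strictlyInverseˡ (inj₁ t))))
                        (sumᵛ-zero (λ t → cong [ z , (λ _ → 0ᵛ) ]′ (strictlyInverseˡ (inj₂ t)))) ⟩
        sumᵛ z +ᵛ 0ᵛ                                             ≡⟨ +ᵛ-identityʳ _ ⟩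
        sumᵛ z                                                   ≡⟨ Σz≡0 ⟩
        0ᵛ                                                       ∎
        where open ≡-Reasoning
      ẑ≡0 = unique ẑ ẑ∈V Σẑ≡0

module HandProperties (K : FiniteField) (G : Family) where
  open FiniteField K
  open LinAlg K
  open Linear K
  open Decompositions K
  open Hands K G
  open Blocks

  module _ {m} (c : Card m) where
    open Card c

    basis : Fin dim → Vect m
    basis = proj₁ hasDim

    basis-indep : LinIndep basis
    basis-indep = proj₁ (proj₂ hasDim)

    label-Within : Within label basis
    label-Within {v} = proj₁ (proj₂ (proj₂ hasDim) v)

    InSpan⇒label : ∀ {v} → InSpan basis v → T (label v)
    InSpan⇒label {v} = proj₂ (proj₂ (proj₂ hasDim) v)

    0ᵛ∈label : T (label 0ᵛ)
    0ᵛ∈label = InSpan⇒label (_ , lincomb-zero basis)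

    basisIf : (b : Bool) → Fin (if b then dim else 0) → Vect m
    basisIf true  = basis
    basisIf false ()

    basisIf-indep : ∀ b → LinIndep (basisIf b)
    basisIf-indep true  = basis-indep
    basisIf-indep false _ _ ()

    lincomb-basisIf∈label : ∀ b x → T (label (lincomb x (basisIf b)))
    lincomb-basisIf∈label true  x = InSpan⇒label (x , refl)
    lincomb-basisIf∈label false x = 0ᵛ∈label

    lincomb-basisIf-false : ∀ b → ¬ T b → ∀ x → lincomb x (basisIf b) ≡ 0ᵛ
    lincomb-basisIf-false true  ¬t _ = ⊥-elim (¬t tt)
    lincomb-basisIf-false false _  _ = refl

    label⇒InSpan-basisIf : ∀ b {v} → T (label v) → (¬ T b → v ≡ 0ᵛ) → InSpan (basisIf b) v
    label⇒InSpan-basisIf true  v∈ _    = label-Within v∈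
    label⇒InSpan-basisIf false _  v≡0 = (λ ()) , sym (v≡0 (λ ()))

  -- A record rather than _≈ᶜ_ itself: being injective, it lets Agda infer the cards from a proof.
  record _≋_ {n} (c c′ : Card n) : Set where
    field
      label≡   : ∀ v → Card.label c v ≡ Card.label c′ v
      picture≡ : Card.picture c ≡ Card.picture c′

  open _≋_ public

  ≋⇒≈ᶜ : ∀ {n} {c c′ : Card n} → c ≋ c′ → c ≈ᶜ c′
  ≋⇒≈ᶜ c≋c′ = label≡ c≋c′ , picture≡ c≋c′

  ≈ᶜ⇒≋ : ∀ {n} {c c′ : Card n} → c ≈ᶜ c′ → c ≋ c′
  ≈ᶜ⇒≋ (eq , eq′) = record { label≡ = eq ; picture≡ = eq′ }

  ≋-setoid : ℕ → Setoid 0ℓ 0ℓ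
  ≋-setoid n = record
    { Carrier = Card n ; _≈_ = _≋_
    ; isEquivalence = record
      { refl  = record { label≡ = λ _ → refl ; picture≡ = refl }
      ; sym   = λ eq → record { label≡ = sym ∘ label≡ eq ; picture≡ = sym (picture≡ eq) }
      ; trans = λ eq eq′ → record { label≡ = λ v → trans (label≡ eq v) (label≡ eq′ v)
                                  ; picture≡ = trans (picture≡ eq) (picture≡ eq′) } } }

  module ≋ {n} = Setoid (≋-setoid n) using () renaming (sym to ≋-sym)
  open ≋ public

  ≋⇒dim≡ : ∀ {n} {c c′ : Card n} → c ≋ c′ → Card.dim c ≡ Card.dim c′
  ≋⇒dim≡ {c = c} {c′} c≋c′ = same-span⇒same-length (basis-indep c) (basis-indep c′)
    (λ v∈ → label-Within c′ (subst T (label≡ c≋c′ _) (InSpan⇒label c v∈)))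
    (λ v∈ → label-Within c (subst T (sym (label≡ c≋c′ _)) (InSpan⇒label c′ v∈)))

  module ≋-Reasoning {n} = Relation.Binary.Reasoning.Setoid (≋-setoid n)

  ≈ʰ-sym : ∀ {m k} (H H′ : Hand m k) → H ≈ʰ H′ → H′ ≈ʰ H
  ≈ʰ-sym H H′ (σ , σ-match) = ↔-sym σ , λ i → ≋⇒≈ᶜ (begin
    Hand.cards H′ (from i)       ≈⟨ ≋-sym (≈ᶜ⇒≋ (σ-match (from i))) ⟩
    Hand.cards H (to (from i))   ≡⟨ cong (Hand.cards H) (strictlyInverseˡ i) ⟩
    Hand.cards H i               ∎)
    where open Inverse σ
          open ≋-Reasoning

  ≈ʰ-trans : ∀ {m k} (H H′ H″ : Hand m k) → H ≈ʰ H′ → H′ ≈ʰ H″ → H ≈ʰ H″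
  ≈ʰ-trans H H′ H″ (σ , σ-match) (τ , τ-match) = ↔-trans τ σ , λ i → ≋⇒≈ᶜ (begin
    Hand.cards H (to σ (to τ i))   ≈⟨ ≈ᶜ⇒≋ (σ-match (to τ i)) ⟩
    Hand.cards H′ (to τ i)         ≈⟨ ≈ᶜ⇒≋ (τ-match i) ⟩
    Hand.cards H″ i                ∎)
    where open Inverse
          open ≋-Reasoning

  module _ {n i} {u : Fin i → Vect n} (indep : LinIndep u) where

    relabel : Card i → Card n
    relabel c = record
      { label = image u (Card.label c) ; picture = Card.picture c ; dim = Card.dim c
      ; hasDim = HasDim-image indep (Card.hasDim c) ; inDeck = Card.inDeck c }

    restrict : (c : Card n) → Within (Card.label c) u → Card i
    restrict c c⊆u = record
      { label = preimage u (Card.label c) ; picture = Card.picture c ; dim = Card.dim c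
      ; hasDim = HasDim-preimage indep c⊆u (Card.hasDim c) ; inDeck = Card.inDeck c }

    relabel-Within : ∀ c → Within (Card.label (relabel c)) u
    relabel-Within c = image-Within (Card.label c)

    relabel-restrict : ∀ c (c⊆u : Within (Card.label c) u) → relabel (restrict c c⊆u) ≋ c
    relabel-restrict c c⊆u = record
      { label≡ = λ v → T⇔⇒≡ image-preimage⁻¹ (image-preimage c⊆u) ; picture≡ = refl }

    relabel-cong : ∀ {c c′} → c ≋ c′ → relabel c ≋ relabel c′
    relabel-cong {c} {c′} c≋c′ = record
      { label≡ = λ v → T⇔⇒≡ (transfer {c} {c′} c≋c′) (transfer {c′} {c} (≋-sym c≋c′)) ; picture≡ = picture≡ c≋c′ }
      where
      transfer : ∀ {c c′} → c ≋ c′ → ∀ {v} → T (image u (Card.label c) v) → T (image u (Card.label c′) v)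
      transfer c≋c′ v∈ = let (x , eq , x∈) = image⇒Image v∈ in
        subst (T ∘ image u _) eq (∈-image (subst T (label≡ c≋c′ x) x∈))

    relabel-injective : ∀ {c c′} → relabel c ≋ relabel c′ → c ≋ c′
    relabel-injective {c} {c′} eq = record
      { label≡ = λ x → T⇔⇒≡ (transfer {c} {c′} eq) (transfer {c′} {c} (≋-sym eq)) ; picture≡ = picture≡ eq }
      where
      transfer : ∀ {c c′} → relabel c ≋ relabel c′ → ∀ {x} → T (Card.label c x) → T (Card.label c′ x)
      transfer eq x∈ = ∈-image⁻¹ indep (subst T (label≡ eq _) (∈-image x∈))

  relabel-≗ : ∀ {n i} {u u′ : Fin i → Vect n} (indep : LinIndep u) (indep′ : LinIndep u′) → u ≗ u′ →
    ∀ c → relabel indep c ≋ relabel indep′ c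
  relabel-≗ {u = u} {u′} indep indep′ u≗u′ c = record
    { label≡ = λ v → T⇔⇒≡ (transfer u≗u′) (transfer (sym ∘ u≗u′)) ; picture≡ = refl }
    where
    transfer : ∀ {u u′ : Fin _ → Vect _} → u ≗ u′ → ∀ {v} → T (image u (Card.label c) v) → T (image u′ (Card.label c) v)
    transfer u≗u′ v∈ = let (x , eq , x∈) = image⇒Image v∈ in
      Image⇒image (x , trans (lincomb-cong (λ _ → refl) (sym ∘ u≗u′)) eq , x∈)

  module Selection {m k} (H : Hand m k) (s : Fin k → Bool) where
    open Hand H

    dims : Fin k → ℕ
    dims l = if s l then Card.dim (cards l) else 0

    selectedBasis : Fin (∑ℕ dims) → Vect m
    selectedBasis = concatᶠ dims (λ l → basisIf (cards l) (s l))

    InSelectedSum : Vect m → Set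
    InSelectedSum v = Σ[ w ∈ (Fin k → Vect m) ]
      (∀ l → T (Card.label (cards l) (w l))) × (∀ l → ¬ T (s l) → w l ≡ 0ᵛ) × sumᵛ w ≡ v

    span⇒InSelectedSum : ∀ {v} → InSpan selectedBasis v → InSelectedSum v
    span⇒InSelectedSum (c , eq) =
      (λ l → lincomb (block dims c l) (basisIf (cards l) (s l))) ,
      (λ l → lincomb-basisIf∈label (cards l) (s l) (block dims c l)) ,
      (λ l ¬sl → lincomb-basisIf-false (cards l) (s l) ¬sl (block dims c l)) ,
      trans (sym (lincomb-concatᶠ dims _ c)) eq

    InSelectedSum⇒span : ∀ {v} → InSelectedSum v → InSpan selectedBasis v
    InSelectedSum⇒span {v} (w , w∈ , w≡0 , Σw≡v) = concatᶠ dims coords , (begin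
      lincomb (concatᶠ dims coords) selectedBasis
        ≡⟨ lincomb-concatᶠ dims _ (concatᶠ dims coords) ⟩
      sumᵛ (λ l → lincomb (block dims (concatᶠ dims coords) l) (basisIf (cards l) (s l)))
        ≡⟨ sumᵛ-cong (λ l → lincomb-cong (block-concatᶠ dims coords l) (λ _ → refl)) ⟩
      sumᵛ (λ l → lincomb (coords l) (basisIf (cards l) (s l)))
        ≡⟨ sumᵛ-cong (λ l → proj₂ (w-coords l)) ⟩
      sumᵛ w
        ≡⟨ Σw≡v ⟩
      v ∎)
      where
      open ≡-Reasoning
      w-coords = λ l → label⇒InSpan-basisIf (cards l) (s l) (w∈ l) (w≡0 l)
      coords = λ l → proj₁ (w-coords l)

    label⊆span : ∀ l → T (s l) → Within (Card.label (cards l)) selectedBasis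
    label⊆span l sl {v} v∈ = InSelectedSum⇒span (single l v , single∈ , single≡0 , sumᵛ-single l v)
      where
      single∈ : ∀ l′ → T (Card.label (cards l′) (single l v l′))
      single∈ l′ with single-cases l v l′
      ... | inj₁ (refl , eq) = subst (T ∘ Card.label (cards l′)) (sym eq) v∈
      ... | inj₂ eq          = subst (T ∘ Card.label (cards l′)) (sym eq) (0ᵛ∈label (cards l′))
      single≡0 : ∀ l′ → ¬ T (s l′) → single l v l′ ≡ 0ᵛ
      single≡0 l′ ¬sl′ with single-cases l v l′
      ... | inj₁ (refl , _) = contradiction sl ¬sl′
      ... | inj₂ eq         = eq

    InSelectedSum-Within : ∀ {a} {u : Fin a → Vect m} → (∀ l → T (s l) → Within (Card.label (cards l)) u) →
      ∀ {v} → InSelectedSum v → InSpan u v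
    InSelectedSum-Within {u = u} labels⊆u (w , w∈ , w≡0 , Σw≡v) = subst (InSpan u) Σw≡v (InSpan-sumᵛ w w⊆u)
      where
      w⊆u : ∀ l → InSpan u (w l)
      w⊆u l with T? (s l)
      ... | yes sl = labels⊆u l sl (w∈ l)
      ... | no ¬sl = (λ _ → 0#) , trans (lincomb-zero u) (sym (w≡0 l ¬sl))

    selectedBasis-indep : LinIndep selectedBasis
    selectedBasis-indep c c≡0 = block-all dims {_≡ 0#} c blocks≡0
      where
      parts = λ l → lincomb (block dims c l) (basisIf (cards l) (s l))
      parts≡0 : ∀ l → parts l ≡ 0ᵛ
      parts≡0 = proj₂ decomp parts (λ l → lincomb-basisIf∈label (cards l) (s l) (block dims c l))
        (trans (sym (lincomb-concatᶠ dims _ c)) c≡0)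
      blocks≡0 : ∀ l t → block dims c l t ≡ 0#
      blocks≡0 l = basisIf-indep (cards l) (s l) (block dims c l) (parts≡0 l)

  hand-dim-sum : ∀ {m k} (H : Hand m k) → ∑ℕ (Card.dim ∘ Hand.cards H) ≡ m
  hand-dim-sum H = same-span⇒same-length selectedBasis-indep stdBasis-indep (λ {v} _ → InSpan-stdBasis v)
    (λ {v} _ → let (w , w∈ , Σw≡v) = proj₁ (Hand.decomp H) v in
               InSelectedSum⇒span (w , w∈ , (λ _ ¬t → ⊥-elim (¬t tt)) , Σw≡v))
    where open Selection H (λ _ → true)

  module Complement {m k} (H : Hand m k) (s : Fin k → Bool) where
    open Hand H
    module S = Selection H s
    module S̄ = Selection H (not ∘ s)

    selected-disjoint : ∀ {x y} → S.InSelectedSum x → S̄.InSelectedSum y → x +ᵛ y ≡ 0ᵛ → x ≡ 0ᵛ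
    selected-disjoint (w , w∈ , w≡0 , Σw≡x) (w̄ , w̄∈ , w̄≡0 , Σw̄≡y) x+y≡0 =
      trans (sym Σw≡x) (sumᵛ-zero w≡0′)
      where
      w̄≡0′ : ∀ l → T (s l) → w̄ l ≡ 0ᵛ
      w̄≡0′ l sl = w̄≡0 l (λ nsl → T-not⇒¬T nsl sl)
      both∈ : ∀ l → T (Card.label (cards l) (w l +ᵛ w̄ l))
      both∈ l with T? (s l)
      ... | yes sl = subst (T ∘ Card.label (cards l)) (sym (trans (cong (w l +ᵛ_) (w̄≡0′ l sl)) (+ᵛ-identityʳ _))) (w∈ l)
      ... | no ¬sl = subst (T ∘ Card.label (cards l)) (sym (trans (cong (_+ᵛ w̄ l) (w≡0 l ¬sl)) (+ᵛ-identityˡ _))) (w̄∈ l)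
      both≡0 : ∀ l → w l +ᵛ w̄ l ≡ 0ᵛ
      both≡0 = proj₂ decomp _ both∈ (trans (sumᵛ-+ᵛ w w̄) (trans (cong₂ _+ᵛ_ Σw≡x Σw̄≡y) x+y≡0))
      w≡0′ : ∀ l → w l ≡ 0ᵛ
      w≡0′ l with T? (s l)
      ... | yes sl = trans (sym (+ᵛ-identityʳ _)) (trans (cong (w l +ᵛ_) (sym (w̄≡0′ l sl))) (both≡0 l))
      ... | no ¬sl = w≡0 l ¬sl

    split-selected : ∀ v → ∃₂ λ x y → S.InSelectedSum x × S̄.InSelectedSum y × x +ᵛ y ≡ v
    split-selected v = sumᵛ w₁ , sumᵛ w₂ , (w₁ , w₁∈ , w₁≡0 , refl) , (w₂ , w₂∈ , w₂≡0 , refl) ,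
      trans (sym (sumᵛ-+ᵛ w₁ w₂)) (trans (sumᵛ-cong w₁+w₂) Σw≡v)
      where
      open Σ (proj₁ decomp v) renaming (proj₁ to w; proj₂ to w-prop)
      w∈ = proj₁ w-prop
      Σw≡v = proj₂ w-prop
      w₁ w₂ : Fin k → Vect m
      w₁ l = if s l then w l else 0ᵛ
      w₂ l = if s l then 0ᵛ else w l
      w₁∈ : ∀ l → T (Card.label (cards l) (w₁ l))
      w₁∈ l with s l
      ... | true  = w∈ l
      ... | false = 0ᵛ∈label (cards l)
      w₂∈ : ∀ l → T (Card.label (cards l) (w₂ l))
      w₂∈ l with s l
      ... | true  = 0ᵛ∈label (cards l)
      ... | false = w∈ l
      w₁≡0 : ∀ l → ¬ T (s l) → w₁ l ≡ 0ᵛ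
      w₁≡0 l ¬sl with s l
      ... | true  = ⊥-elim (¬sl tt)
      ... | false = refl
      w₂≡0 : ∀ l → ¬ T (not (s l)) → w₂ l ≡ 0ᵛ
      w₂≡0 l ¬nsl with s l
      ... | true  = refl
      ... | false = ⊥-elim (¬nsl tt)
      w₁+w₂ : ∀ l → w₁ l +ᵛ w₂ l ≡ w l
      w₁+w₂ l with s l
      ... | true  = +ᵛ-identityʳ (w l)
      ... | false = +ᵛ-identityˡ (w l)

    selectedBases : Fin (∑ℕ S.dims ℕ.+ ∑ℕ S̄.dims) → Vect m
    selectedBases = S.selectedBasis ++ᶠ S̄.selectedBasis

    selectedBases-indep : LinIndep selectedBases
    selectedBases-indep = LinIndep-++ S.selectedBasis-indep S̄.selectedBasis-indep
      (λ c₁ c₂ → selected-disjoint (S.span⇒InSelectedSum (c₁ , refl)) (S̄.span⇒InSelectedSum (c₂ , refl)))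

    selectedBases-span : ∀ v → InSpan selectedBases v
    selectedBases-span v =
      let (x , y , x∈ , y∈ , x+y≡v) = split-selected v
          (c₁ , c₁≡x) = S.InSelectedSum⇒span x∈
          (c₂ , c₂≡y) = S̄.InSelectedSum⇒span y∈
      in c₁ ++ᶠ c₂ , trans (lincomb-++-++ c₁ c₂ _ _) (trans (cong₂ _+ᵛ_ c₁≡x c₂≡y) x+y≡v)

    selected-dims : ∑ℕ S.dims ℕ.+ ∑ℕ S̄.dims ≡ m
    selected-dims = same-span⇒same-length selectedBases-indep stdBasis-indep
      (λ {v} _ → InSpan-stdBasis v) (λ {v} _ → selectedBases-span v)

module Merger (K : FiniteField) (F′ F″ : Family) where
  open FiniteField K using (q)
  open LinAlg K
  open Linear K
  open Decompositions K
  open Counting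

  module HF = Hands K (F′ ⊕ F″)
  module H′ = Hands K F′
  module H″ = Hands K F″
  module FF = HandProperties K (F′ ⊕ F″)
  module F′F = HandProperties K F′
  module F″F = HandProperties K F″
  open FF using (_≋_; ≋-sym; ≋⇒≈ᶜ; ≈ᶜ⇒≋; label≡; picture≡)

  lift′ : ∀ {n} → H′.Card n → HF.Card n
  lift′ c = record { H′.Card c ; picture = inj₁ (H′.Card.picture c) }

  lift″ : ∀ {n} → H″.Card n → HF.Card n
  lift″ c = record { H″.Card c ; picture = inj₂ (H″.Card.picture c) }

  OnLeft : ∀ {n} → HF.Card n → Set
  OnLeft c = T (isInj₁ (HF.Card.picture c))

  private
    open Family

    fromLeft : ∀ {d} (p : Pic F′ ⊎ Pic F″) → T (isInj₁ p) → T (deck (F′ ⊕ F″) d p) →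
      Σ[ p′ ∈ Pic F′ ] T (deck F′ d p′) × inj₁ p′ ≡ p
    fromLeft (inj₁ p) _ p∈ = p , p∈ , refl

    fromRight : ∀ {d} (p : Pic F′ ⊎ Pic F″) → ¬ T (isInj₁ p) → T (deck (F′ ⊕ F″) d p) →
      Σ[ p″ ∈ Pic F″ ] T (deck F″ d p″) × inj₂ p″ ≡ p
    fromRight (inj₁ p) onRight _  = ⊥-elim (onRight tt)
    fromRight (inj₂ p) _       p∈ = p , p∈ , refl

  unlift′ : ∀ {n} (c : HF.Card n) → OnLeft c → H′.Card n
  unlift′ c onLeft = record { HF.Card c ; picture = proj₁ p′ ; inDeck = proj₁ (proj₂ p′) }
    where p′ = fromLeft _ onLeft (HF.Card.inDeck c)

  unlift″ : ∀ {n} (c : HF.Card n) → ¬ OnLeft c → H″.Card n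
  unlift″ c onRight = record { HF.Card c ; picture = proj₁ p″ ; inDeck = proj₁ (proj₂ p″) }
    where p″ = fromRight _ onRight (HF.Card.inDeck c)

  lift-unlift′ : ∀ {n} (c : HF.Card n) onLeft → lift′ (unlift′ c onLeft) ≋ c
  lift-unlift′ c onLeft =
    record { label≡ = λ _ → refl ; picture≡ = proj₂ (proj₂ (fromLeft _ onLeft (HF.Card.inDeck c))) }

  lift-unlift″ : ∀ {n} (c : HF.Card n) onRight → lift″ (unlift″ c onRight) ≋ c
  lift-unlift″ c onRight =
    record { label≡ = λ _ → refl ; picture≡ = proj₂ (proj₂ (fromRight _ onRight (HF.Card.inDeck c))) }

  lift-cong′ : ∀ {n} {c c′ : H′.Card n} → c F′F.≋ c′ → lift′ c ≋ lift′ c′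
  lift-cong′ eq = record { label≡ = F′F.label≡ eq ; picture≡ = cong inj₁ (F′F.picture≡ eq) }

  lift-cong″ : ∀ {n} {c c′ : H″.Card n} → c F″F.≋ c′ → lift″ c ≋ lift″ c′
  lift-cong″ eq = record { label≡ = F″F.label≡ eq ; picture≡ = cong inj₂ (F″F.picture≡ eq) }

  lift-injective′ : ∀ {n} {c c′ : H′.Card n} → lift′ c ≋ lift′ c′ → c F′F.≋ c′
  lift-injective′ eq = record { label≡ = label≡ eq ; picture≡ = inj₁-injective (picture≡ eq) }

  lift-injective″ : ∀ {n} {c c′ : H″.Card n} → lift″ c ≋ lift″ c′ → c F″F.≋ c′
  lift-injective″ eq = record { label≡ = label≡ eq ; picture≡ = inj₂-injective (picture≡ eq) }

  ∑-cards-cong : ∀ {n k} (g : HF.Card n → ℕ) → (∀ {c c′} → c ≋ c′ → g c ≡ g c′) →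
    ∀ {H H′ : HF.Hand n k} → H HF.≈ʰ H′ → ∑ℕ (g ∘ HF.Hand.cards H) ≡ ∑ℕ (g ∘ HF.Hand.cards H′)
  ∑-cards-cong g g-cong {H} {H′} (σ , σ-match) =
    trans (∑ℕ-permute (g ∘ HF.Hand.cards H) σ) (∑ℕ-cong (λ t → g-cong (≈ᶜ⇒≋ (σ-match t))))

  module Type {n k} (H : HF.Hand n k) where
    open HF.Hand H

    onLeft : Fin k → Bool
    onLeft l = isInj₁ (HF.Card.picture (cards l))

    leftCount : ℕ
    leftCount = count (T? ∘ onLeft)

    open FF.Complement H onLeft public using (module S; module S̄; selected-dims; selectedBases-indep; selected-disjoint)

    leftDim rightDim : ℕ
    leftDim  = ∑ℕ S.dims
    rightDim = ∑ℕ S̄.dims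

  HasType : ℕ → ℕ → ∀ {n k} → HF.Hand n k → Set
  HasType i j H = Type.leftDim H ≡ i × Type.leftCount H ≡ j

  hasType? : ∀ i j {n k} → Decidable (HasType i j {n} {k})
  hasType? i j H = (Type.leftDim H ≟ i) ×-dec (Type.leftCount H ≟ j)

  HasType-cong : ∀ {i j n k} {H H′ : HF.Hand n k} → H HF.≈ʰ H′ → HasType i j H′ → HasType i j H
  HasType-cong {H = H} {H′} H≈H′ (dim≡ , count≡) =
    trans (∑-cards-cong leftDimOf (λ eq → cong₂ (λ b d → if b then d else 0) (cong isInj₁ (picture≡ eq)) (FF.≋⇒dim≡ eq))
                        {H} {H′} H≈H′) dim≡ ,
    trans (∑-cards-cong leftCountOf (λ eq → cong (λ b → if b then 1 else 0) (cong isInj₁ (picture≡ eq)))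
                        {H} {H′} H≈H′) count≡
    where
    leftDimOf leftCountOf : HF.Card _ → ℕ
    leftDimOf c = if isInj₁ (HF.Card.picture c) then HF.Card.dim c else 0
    leftCountOf c = if isInj₁ (HF.Card.picture c) then 1 else 0

  Bases : ℕ → ℕ → ℕ → Set
  Bases n i i₂ = (Fin i → Vect n) × (Fin i₂ → Vect n)

  _≗ᵇ_ : ∀ {n i i₂} → Bases n i i₂ → Bases n i i₂ → Set
  _≗ᵇ_ = Pointwise _≗_ _≗_

  ≗ᵇ-sym : ∀ {n i i₂} {b b′ : Bases n i i₂} → b ≗ᵇ b′ → b′ ≗ᵇ b
  ≗ᵇ-sym (eq , eq′) = sym ∘ eq , sym ∘ eq′

  ≗ᵇ-trans : ∀ {n i i₂} {b b′ b″ : Bases n i i₂} → b ≗ᵇ b′ → b′ ≗ᵇ b″ → b ≗ᵇ b″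
  ≗ᵇ-trans (eq₁ , eq₂) (eq₁′ , eq₂′) = (λ l → trans (eq₁ l) (eq₁′ l)) , (λ l → trans (eq₂ l) (eq₂′ l))

  Adapted : ∀ {n k i i₂} → HF.Hand n k → Bases n i i₂ → Set
  Adapted H (u , w) = LinIndep (u ++ᶠ w)
    × (∀ l → T (onLeft l) → Within (HF.Card.label (cards l)) u)
    × (∀ l → ¬ T (onLeft l) → Within (HF.Card.label (cards l)) w)
    where open HF.Hand H
          open Type H using (onLeft)

  Adapted-cong : ∀ {n k i i₂} {H H′ : HF.Hand n k} {b : Bases n i i₂} → H HF.≈ʰ H′ → Adapted H′ b → Adapted H b
  Adapted-cong {H = H} {H′} (σ , σ-match) (indep , left⊆u , right⊆w) = indep , left⊆u′ , right⊆w′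
    where
    open Inverse σ
    match : ∀ l → HF.Hand.cards H l ≋ HF.Hand.cards H′ (from l)
    match l = subst (λ l′ → HF.Hand.cards H l′ ≋ HF.Hand.cards H′ (from l)) (strictlyInverseˡ l) (≈ᶜ⇒≋ (σ-match (from l)))
    onLeft≡ : ∀ l → Type.onLeft H l ≡ Type.onLeft H′ (from l)
    onLeft≡ l = cong isInj₁ (picture≡ (match l))
    left⊆u′ = λ l onLeft {v} v∈ → left⊆u (from l) (subst T (onLeft≡ l) onLeft) (subst T (label≡ (match l) v) v∈)
    right⊆w′ = λ l onRight {v} v∈ → right⊆w (from l) (onRight ∘ subst T (sym (onLeft≡ l))) (subst T (label≡ (match l) v) v∈)

  module Fibre {i i₂ k} (H : HF.Hand (i ℕ.+ i₂) k) (leftDim≡i : Type.leftDim H ≡ i) where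
    open Type H
    private
      β₁ = S.selectedBasis
      β₂ = S̄.selectedBasis

    rightDim≡i₂ : rightDim ≡ i₂
    rightDim≡i₂ = ℕ.+-cancelˡ-≡ i _ _ (trans (cong (ℕ._+ rightDim) (sym leftDim≡i)) selected-dims)

    adapted : IndepIn β₁ i × IndepIn β₂ i₂ → Σ (Bases (i ℕ.+ i₂) i i₂) (Adapted H)
    adapted ((u , u⊆β₁ , u-indep) , (w , w⊆β₂ , w-indep)) = (u , w) , indep , left⊆u , right⊆w
      where
      indep = LinIndep-++ u-indep w-indep (λ c₁ c₂ → selected-disjoint
        (S.span⇒InSelectedSum (InSpan-lincomb u⊆β₁ c₁)) (S̄.span⇒InSelectedSum (InSpan-lincomb w⊆β₂ c₂)))
      left⊆u = λ l onLeft {v} v∈ → indep-of-full-length-spans S.selectedBasis-indep leftDim≡i u⊆β₁ u-indep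
                                 (S.label⊆span l onLeft v∈)
      right⊆w = λ l onRight {v} v∈ → indep-of-full-length-spans S̄.selectedBasis-indep rightDim≡i₂ w⊆β₂ w-indep
                                   (S̄.label⊆span l (¬T⇒T-not onRight) v∈)

    adapted-surj : ∀ (b : Σ (Bases (i ℕ.+ i₂) i i₂) (Adapted H)) → ∃ λ x → proj₁ (adapted x) ≗ᵇ proj₁ b
    adapted-surj ((u , w) , indep , left⊆u , right⊆w) =
      ((u , u⊆β₁ , u-indep) , (w , w⊆β₂ , w-indep)) , (λ _ → refl) , (λ _ → refl)
      where
      u-indep = LinIndep-++⁻ˡ indep
      w-indep = LinIndep-++⁻ʳ indep
      β₁⊆u = λ p → S.InSelectedSum-Within left⊆u (S.span⇒InSelectedSum (δ p , lincomb-δ β₁ p))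
      β₂⊆w = λ p → S̄.InSelectedSum-Within (λ l onRight → right⊆w l (T-not⇒¬T onRight)) (S̄.span⇒InSelectedSum (δ p , lincomb-δ β₂ p))
      u⊆β₁ = λ l → indep-of-full-length-spans u-indep (sym leftDim≡i) β₁⊆u S.selectedBasis-indep (δ l , lincomb-δ u l)
      w⊆β₂ = λ l → indep-of-full-length-spans w-indep (sym rightDim≡i₂) β₂⊆w S̄.selectedBasis-indep (δ l , lincomb-δ w l)

    adapted-card : HasCard {Σ (Bases (i ℕ.+ i₂) i i₂) (Adapted H)} (_≗ᵇ_ on proj₁) (γ q i ℕ.* γ q i₂)
    adapted-card = HasCard-map {R = Pointwise (_≗_ on proj₁) (_≗_ on proj₁)} {S = _≗ᵇ_ on proj₁} adapted
      (λ eq → eq) (λ eq → eq) adapted-surj ≗ᵇ-trans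
      (HasCard-× {R = _≗_ on proj₁} {S = _≗_ on proj₁}
        (bases-card S.selectedBasis-indep leftDim≡i) (bases-card S̄.selectedBasis-indep rightDim≡i₂))
      where
      bases-card : ∀ {d m} {β : Fin d → Vect (i ℕ.+ i₂)} → LinIndep β → d ≡ m → HasCard {IndepIn β m} (_≗_ on proj₁) (γ q m)
      bases-card indep refl = IndepIn-card indep _

  ∑ℕ-zero : ∀ N → ∑ℕ {N} (λ _ → 0) ≡ 0
  ∑ℕ-zero zero    = refl
  ∑ℕ-zero (suc N) = ∑ℕ-zero N

  ∑ℕ-one : ∀ N → ∑ℕ {N} (λ _ → 1) ≡ N
  ∑ℕ-one zero    = refl
  ∑ℕ-one (suc N) = cong suc (∑ℕ-one N)

  module Merge {i i₂ j j₂} {u : Fin i → Vect (i ℕ.+ i₂)} {w : Fin i₂ → Vect (i ℕ.+ i₂)}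
               (indep : LinIndep (u ++ᶠ w)) (G′ : H′.Hand i j) (G″ : H″.Hand i₂ j₂) where
    u-indep : LinIndep u
    u-indep = LinIndep-++⁻ˡ {u = u} {w = w} indep

    w-indep : LinIndep w
    w-indep = LinIndep-++⁻ʳ {u = u} {w = w} indep

    left : Fin j → HF.Card (i ℕ.+ i₂)
    left a = lift′ (F′F.relabel u-indep (H′.Hand.cards G′ a))

    right : Fin j₂ → HF.Card (i ℕ.+ i₂)
    right b = lift″ (F″F.relabel w-indep (H″.Hand.cards G″ b))

    cards : Fin (j ℕ.+ j₂) → HF.Card (i ℕ.+ i₂)
    cards = left ++ᶠ right

    onLeft-↑ˡ : ∀ a → isInj₁ (HF.Card.picture (cards (a ↑ˡ j₂))) ≡ true
    onLeft-↑ˡ a = cong (isInj₁ ∘ HF.Card.picture) (lookup-++ˡ left right a)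

    onLeft-↑ʳ : ∀ b → isInj₁ (HF.Card.picture (cards (j ↑ʳ b))) ≡ false
    onLeft-↑ʳ b = cong (isInj₁ ∘ HF.Card.picture) (lookup-++ʳ left right b)

    distinct : ∀ t t′ → cards t HF.≈ᶜ cards t′ → t ≡ t′
    distinct = ↑-elim (λ a → ↑-elim (λ a′ eq → cong (_↑ˡ j₂) (distinct-left (≈ᶜ⇒≋ eq)))
                                     (λ b′ eq → ⊥-elim (different-sides (onLeft-↑ˡ a) (onLeft-↑ʳ b′) (proj₂ eq))))
                      (λ b → ↑-elim (λ a′ eq → ⊥-elim (different-sides (onLeft-↑ˡ a′) (onLeft-↑ʳ b) (sym (proj₂ eq))))
                                     (λ b′ eq → cong (j ↑ʳ_) (distinct-right (≈ᶜ⇒≋ eq))))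
      where
      different-sides : ∀ {t t′} → isInj₁ (HF.Card.picture (cards t)) ≡ true → isInj₁ (HF.Card.picture (cards t′)) ≡ false →
        HF.Card.picture (cards t) ≢ HF.Card.picture (cards t′)
      different-sides onLeft onRight picture≡ = contradiction (trans (sym onLeft) (trans (cong isInj₁ picture≡) onRight)) (λ ())
      distinct-left : ∀ {a a′} → cards (a ↑ˡ j₂) ≋ cards (a′ ↑ˡ j₂) → a ≡ a′
      distinct-left {a} {a′} eq = H′.Hand.distinct G′ a a′ (F′F.≋⇒≈ᶜ (F′F.relabel-injective u-indep {c} {c′} (lift-injective′ (begin
        left a              ≡⟨ lookup-++ˡ left right a ⟨
        cards (a ↑ˡ j₂)     ≈⟨ eq ⟩
        cards (a′ ↑ˡ j₂)    ≡⟨ lookup-++ˡ left right a′ ⟩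
        left a′             ∎))))
        where open FF.≋-Reasoning
              c = H′.Hand.cards G′ a
              c′ = H′.Hand.cards G′ a′
      distinct-right : ∀ {b b′} → cards (j ↑ʳ b) ≋ cards (j ↑ʳ b′) → b ≡ b′
      distinct-right {b} {b′} eq = H″.Hand.distinct G″ b b′ (F″F.≋⇒≈ᶜ (F″F.relabel-injective w-indep {c} {c′} (lift-injective″ (begin
        right b             ≡⟨ lookup-++ʳ left right b ⟨
        cards (j ↑ʳ b)      ≈⟨ eq ⟩
        cards (j ↑ʳ b′)     ≡⟨ lookup-++ʳ left right b′ ⟩
        right b′            ∎))))
        where open FF.≋-Reasoning
              c = H″.Hand.cards G″ b
              c′ = H″.Hand.cards G″ b′

    label-cards : ∀ t → HF.Card.label (cards t) ≡ ((HF.Card.label ∘ left) ++ᶠ (HF.Card.label ∘ right)) t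
    label-cards = ↑-elim (λ a → trans (cong HF.Card.label (lookup-++ˡ left right a)) (sym (lookup-++ˡ (HF.Card.label ∘ left) _ a)))
                         (λ b → trans (cong HF.Card.label (lookup-++ʳ left right b)) (sym (lookup-++ʳ (HF.Card.label ∘ left) _ b)))

    decomp : DirectSumDecomp (HF.Card.label ∘ cards)
    decomp = Decomposes⇒DirectSumDecomp {V = HF.Card.label ∘ cards}
      (Decomposes-cong (sym ∘ label-cards)
        (Decomposes-++ indep (λ a → F′F.relabel-Within u-indep (H′.Hand.cards G′ a))
                             (λ b → F″F.relabel-Within w-indep (H″.Hand.cards G″ b))
                             (Decomposes-image u-indep (H′.Hand.decomp G′)) (Decomposes-image w-indep (H″.Hand.decomp G″))))
      (λ v → indep-of-full-length-spans stdBasis-indep refl (λ _ → InSpan-stdBasis _) indep (InSpan-stdBasis v))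

    merged : HF.Hand (i ℕ.+ i₂) (j ℕ.+ j₂)
    merged = record { cards = cards ; distinct = distinct ; decomp = decomp }

    ∑-merged : ∀ (g : HF.Card (i ℕ.+ i₂) → ℕ) → ∑ℕ (g ∘ cards) ≡ ∑ℕ (g ∘ left) ℕ.+ ∑ℕ (g ∘ right)
    ∑-merged g = trans (sum-↑ ℕ.+-0-monoid {j} (g ∘ cards))
      (cong₂ ℕ._+_ (∑ℕ-cong (cong g ∘ lookup-++ˡ left right)) (∑ℕ-cong (cong g ∘ lookup-++ʳ left right)))

    merged-type : HasType i j merged
    merged-type =
      trans (∑-merged (λ c → if isInj₁ (HF.Card.picture c) then HF.Card.dim c else 0))
            (trans (cong₂ ℕ._+_ (F′F.hand-dim-sum G′) (∑ℕ-zero j₂)) (ℕ.+-identityʳ i)) ,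
      trans (∑-merged (λ c → if isInj₁ (HF.Card.picture c) then 1 else 0))
            (trans (cong₂ ℕ._+_ (∑ℕ-one j) (∑ℕ-zero j₂)) (ℕ.+-identityʳ j))

    merged-adapted : Adapted merged (u , w)
    merged-adapted = indep ,
      ↑-elim (λ a _ → subst (λ c → Within (HF.Card.label c) u) (sym (lookup-++ˡ left right a))
                            (F′F.relabel-Within u-indep (H′.Hand.cards G′ a)))
             (λ b onLeft → ⊥-elim (subst T (onLeft-↑ʳ b) onLeft)) ,
      ↑-elim (λ a onRight → ⊥-elim (onRight (subst T (sym (onLeft-↑ˡ a)) tt)))
             (λ b _ → subst (λ c → Within (HF.Card.label c) w) (sym (lookup-++ʳ left right b))
                            (F″F.relabel-Within w-indep (H″.Hand.cards G″ b)))

  module MergeCongruence {i i₂ j j₂} {u u′ : Fin i → Vect (i ℕ.+ i₂)} {w w′ : Fin i₂ → Vect (i ℕ.+ i₂)}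
    (indep : LinIndep (u ++ᶠ w)) (indep′ : LinIndep (u′ ++ᶠ w′)) (b≗b′ : (u , w) ≗ᵇ (u′ , w′))
    {G′₁ G′₂ : H′.Hand i j} {G″₁ G″₂ : H″.Hand i₂ j₂} where
    private
      u≗u′ = proj₁ b≗b′
      w≗w′ = proj₂ b≗b′
    module M₁ = Merge indep G′₁ G″₁
    module M₂ = Merge indep′ G′₂ G″₂
    open FF.≋-Reasoning

    left≋ : ∀ {a a′} → H′.Hand.cards G′₁ a F′F.≋ H′.Hand.cards G′₂ a′ → M₁.left a ≋ M₂.left a′
    left≋ {a} {a′} eq = begin
      lift′ (F′F.relabel M₁.u-indep c)   ≈⟨ lift-cong′ {c = F′F.relabel M₁.u-indep c} (F′F.relabel-cong M₁.u-indep {c} {c′} eq) ⟩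
      lift′ (F′F.relabel M₁.u-indep c′)  ≈⟨ lift-cong′ {c = F′F.relabel M₁.u-indep c′} (F′F.relabel-≗ M₁.u-indep M₂.u-indep u≗u′ c′) ⟩
      lift′ (F′F.relabel M₂.u-indep c′)  ∎
      where c = H′.Hand.cards G′₁ a
            c′ = H′.Hand.cards G′₂ a′

    right≋ : ∀ {b b′} → H″.Hand.cards G″₁ b F″F.≋ H″.Hand.cards G″₂ b′ → M₁.right b ≋ M₂.right b′
    right≋ {b} {b′} eq = begin
      lift″ (F″F.relabel M₁.w-indep c)   ≈⟨ lift-cong″ {c = F″F.relabel M₁.w-indep c} (F″F.relabel-cong M₁.w-indep {c} {c′} eq) ⟩
      lift″ (F″F.relabel M₁.w-indep c′)  ≈⟨ lift-cong″ {c = F″F.relabel M₁.w-indep c′} (F″F.relabel-≗ M₁.w-indep M₂.w-indep w≗w′ c′) ⟩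
      lift″ (F″F.relabel M₂.w-indep c′)  ∎
      where c = H″.Hand.cards G″₁ b
            c′ = H″.Hand.cards G″₂ b′

    merged-cong : G′₁ H′.≈ʰ G′₂ → G″₁ H″.≈ʰ G″₂ → M₁.merged HF.≈ʰ M₂.merged
    merged-cong (σ , σ-match) (τ , τ-match) = π , λ t → ≋⇒≈ᶜ (match t)
      where
      π = ↔-trans +↔⊎ (↔-trans (σ ⊎-↔ τ) (↔-sym +↔⊎))
      match : ∀ t → M₁.cards (Inverse.to π t) ≋ M₂.cards t
      match = ↑-elim
        (λ a → begin
          M₁.cards (Inverse.to π (a ↑ˡ j₂))           ≡⟨ cong (λ x → M₁.cards (Fin.join j j₂ (Inverse.to (σ ⊎-↔ τ) x))) (splitAt-↑ˡ j a j₂) ⟩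
          M₁.cards (Inverse.to σ a ↑ˡ j₂)             ≡⟨ lookup-++ˡ M₁.left M₁.right _ ⟩
          M₁.left (Inverse.to σ a)                    ≈⟨ left≋ (F′F.≈ᶜ⇒≋ (σ-match a)) ⟩
          M₂.left a                                   ≡⟨ lookup-++ˡ M₂.left M₂.right a ⟨
          M₂.cards (a ↑ˡ j₂)                          ∎)
        (λ b → begin
          M₁.cards (Inverse.to π (j ↑ʳ b))            ≡⟨ cong (λ x → M₁.cards (Fin.join j j₂ (Inverse.to (σ ⊎-↔ τ) x))) (splitAt-↑ʳ j j₂ b) ⟩
          M₁.cards (j ↑ʳ Inverse.to τ b)              ≡⟨ lookup-++ʳ M₁.left M₁.right _ ⟩
          M₁.right (Inverse.to τ b)                   ≈⟨ right≋ (F″F.≈ᶜ⇒≋ (τ-match b)) ⟩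
          M₂.right b                                  ≡⟨ lookup-++ʳ M₂.left M₂.right b ⟨
          M₂.cards (j ↑ʳ b)                           ∎)

    merged-injective : M₁.merged HF.≈ʰ M₂.merged → G′₁ H′.≈ʰ G′₂ × G″₁ H″.≈ʰ G″₂
    merged-injective (π , π-match) = (σˡ , λ a → F′F.≋⇒≈ᶜ (left-match a)) , (σʳ , λ b → F″F.≋⇒≈ᶜ (right-match b))
      where
      side₁ : ∀ t → isInj₁ (HF.Card.picture (M₁.cards t)) ≡ isInj₁ (splitAt j t)
      side₁ t with splitAt j t
      ... | inj₁ _ = refl
      ... | inj₂ _ = refl
      side₂ : ∀ t → isInj₁ (HF.Card.picture (M₂.cards t)) ≡ isInj₁ (splitAt j t)
      side₂ t with splitAt j t
      ... | inj₁ _ = refl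
      ... | inj₂ _ = refl
      π-preserves : ∀ t → isInj₁ (splitAt j (Inverse.to π t)) ≡ isInj₁ (splitAt j t)
      π-preserves t = trans (sym (side₁ (Inverse.to π t))) (trans (cong isInj₁ (proj₂ (π-match t))) (side₂ t))
      open RestrictPermutation π π-preserves
      left-match : ∀ a → H′.Hand.cards G′₁ (Inverse.to σˡ a) F′F.≋ H′.Hand.cards G′₂ a
      left-match a = F′F.relabel-injective M₁.u-indep {c} {c′} (lift-injective′ {c = F′F.relabel M₁.u-indep c} (begin
        lift′ (F′F.relabel M₁.u-indep c)    ≡⟨ lookup-++ˡ M₁.left M₁.right _ ⟨
        M₁.cards (Inverse.to σˡ a ↑ˡ j₂)    ≡⟨ cong M₁.cards (σ-↑ˡ a) ⟨
        M₁.cards (Inverse.to π (a ↑ˡ j₂))   ≈⟨ ≈ᶜ⇒≋ (π-match (a ↑ˡ j₂)) ⟩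
        M₂.cards (a ↑ˡ j₂)                  ≡⟨ lookup-++ˡ M₂.left M₂.right a ⟩
        lift′ (F′F.relabel M₂.u-indep c′)   ≈⟨ lift-cong′ {c = F′F.relabel M₂.u-indep c′} (F′F.relabel-≗ M₂.u-indep M₁.u-indep (sym ∘ u≗u′) c′) ⟩
        lift′ (F′F.relabel M₁.u-indep c′)   ∎))
        where c = H′.Hand.cards G′₁ (Inverse.to σˡ a)
              c′ = H′.Hand.cards G′₂ a
      right-match : ∀ b → H″.Hand.cards G″₁ (Inverse.to σʳ b) F″F.≋ H″.Hand.cards G″₂ b
      right-match b = F″F.relabel-injective M₁.w-indep {c} {c′} (lift-injective″ {c = F″F.relabel M₁.w-indep c} (begin
        lift″ (F″F.relabel M₁.w-indep c)    ≡⟨ lookup-++ʳ M₁.left M₁.right _ ⟨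
        M₁.cards (j ↑ʳ Inverse.to σʳ b)     ≡⟨ cong M₁.cards (σ-↑ʳ b) ⟨
        M₁.cards (Inverse.to π (j ↑ʳ b))    ≈⟨ ≈ᶜ⇒≋ (π-match (j ↑ʳ b)) ⟩
        M₂.cards (j ↑ʳ b)                   ≡⟨ lookup-++ʳ M₂.left M₂.right b ⟩
        lift″ (F″F.relabel M₂.w-indep c′)   ≈⟨ lift-cong″ {c = F″F.relabel M₂.w-indep c′} (F″F.relabel-≗ M₂.w-indep M₁.w-indep (sym ∘ w≗w′) c′) ⟩
        lift″ (F″F.relabel M₁.w-indep c′)   ∎))
        where c = H″.Hand.cards G″₁ (Inverse.to σʳ b)
              c′ = H″.Hand.cards G″₂ b

module Extraction (K : FiniteField) (F′ F″ : Family) where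
  open FiniteField K using (q)
  open LinAlg K
  open Linear K
  open Decompositions K
  open Counting
  open Merger K F′ F″
  open FF using (_≋_; ≋-sym; ≋⇒≈ᶜ; ≈ᶜ⇒≋)

  module Extract {i i₂ j j₂} (H : HF.Hand (i ℕ.+ i₂) (j ℕ.+ j₂)) (type : HasType i j H)
                 {u : Fin i → Vect (i ℕ.+ i₂)} {w : Fin i₂ → Vect (i ℕ.+ i₂)} (adapted : Adapted H (u , w)) where
    private
      leftCount≡j = proj₂ type
      indep = proj₁ adapted
      left⊆u = proj₁ (proj₂ adapted)
      right⊆w = proj₂ (proj₂ adapted)
    open HF.Hand H
    open Type H using (onLeft; leftCount)

    u-indep : LinIndep u
    u-indep = LinIndep-++⁻ˡ {u = u} {w = w} indep

    w-indep : LinIndep w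
    w-indep = LinIndep-++⁻ʳ {u = u} {w = w} indep

    onLeft? : Decidable (T ∘ onLeft)
    onLeft? = T? ∘ onLeft

    rightCount≡j₂ : count (λ l → ¬? (onLeft? l)) ≡ j₂
    rightCount≡j₂ = ℕ.+-cancelˡ-≡ j _ _ (trans (cong (ℕ._+ count (λ l → ¬? (onLeft? l))) (sym leftCount≡j)) (count+count-∁ onLeft?))

    leftIndices : HasCard (_≡_ on proj₁) j
    leftIndices = subst (HasCard (_≡_ on proj₁)) leftCount≡j (HasCard-filterFin onLeft?)

    rightIndices : HasCard (_≡_ on proj₁) j₂
    rightIndices = subst (HasCard (_≡_ on proj₁)) rightCount≡j₂ (HasCard-filterFin (λ l → ¬? (onLeft? l)))

    ρ : Fin (j ℕ.+ j₂) ↔ (Fin j ⊎ Fin j₂)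
    ρ = partition↔ onLeft? leftIndices rightIndices

    onLeft-l₁ : ∀ a → T (onLeft (Inverse.from ρ (inj₁ a)))
    onLeft-l₁ = partition↔-inj₁ onLeft? leftIndices rightIndices

    onRight-l₂ : ∀ b → ¬ T (onLeft (Inverse.from ρ (inj₂ b)))
    onRight-l₂ = partition↔-inj₂ onLeft? leftIndices rightIndices

    open Inverse ρ

    l₁ : Fin j → Fin (j ℕ.+ j₂)
    l₁ = from ∘ inj₁

    l₂ : Fin j₂ → Fin (j ℕ.+ j₂)
    l₂ = from ∘ inj₂

    leftLabels⊆u : ∀ a → Within (HF.Card.label (cards (l₁ a))) u
    leftLabels⊆u a = left⊆u (l₁ a) (onLeft-l₁ a)

    rightLabels⊆w : ∀ b → Within (HF.Card.label (cards (l₂ b))) w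
    rightLabels⊆w b = right⊆w (l₂ b) (onRight-l₂ b)

    leftCards : Fin j → H′.Card i
    leftCards a = F′F.restrict u-indep (unlift′ (cards (l₁ a)) (onLeft-l₁ a)) (leftLabels⊆u a)

    rightCards : Fin j₂ → H″.Card i₂
    rightCards b = F″F.restrict w-indep (unlift″ (cards (l₂ b)) (onRight-l₂ b)) (rightLabels⊆w b)

    leftCards-≋ : ∀ a → lift′ (F′F.relabel u-indep (leftCards a)) ≋ cards (l₁ a)
    leftCards-≋ a = begin
      lift′ (F′F.relabel u-indep (leftCards a))
        ≈⟨ lift-cong′ {c = F′F.relabel u-indep (leftCards a)} (F′F.relabel-restrict u-indep c (leftLabels⊆u a)) ⟩
      lift′ c                                    ≈⟨ lift-unlift′ (cards (l₁ a)) (onLeft-l₁ a) ⟩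
      cards (l₁ a)                               ∎
      where open FF.≋-Reasoning
            c = unlift′ (cards (l₁ a)) (onLeft-l₁ a)

    rightCards-≋ : ∀ b → lift″ (F″F.relabel w-indep (rightCards b)) ≋ cards (l₂ b)
    rightCards-≋ b = begin
      lift″ (F″F.relabel w-indep (rightCards b))
        ≈⟨ lift-cong″ {c = F″F.relabel w-indep (rightCards b)} (F″F.relabel-restrict w-indep c (rightLabels⊆w b)) ⟩
      lift″ c                                    ≈⟨ lift-unlift″ (cards (l₂ b)) (onRight-l₂ b) ⟩
      cards (l₂ b)                               ∎
      where open FF.≋-Reasoning
            c = unlift″ (cards (l₂ b)) (onRight-l₂ b)

    inj₁-l₁ : ∀ {a a′} → l₁ a ≡ l₁ a′ → a ≡ a′
    inj₁-l₁ {a} {a′} eq = inj₁-injective (trans (sym (strictlyInverseˡ (inj₁ a))) (trans (cong to eq) (strictlyInverseˡ (inj₁ a′))))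

    inj₂-l₂ : ∀ {b b′} → l₂ b ≡ l₂ b′ → b ≡ b′
    inj₂-l₂ {b} {b′} eq = inj₂-injective (trans (sym (strictlyInverseˡ (inj₂ b))) (trans (cong to eq) (strictlyInverseˡ (inj₂ b′))))

    leftCards-distinct : ∀ a a′ → leftCards a H′.≈ᶜ leftCards a′ → a ≡ a′
    leftCards-distinct a a′ eq = inj₁-l₁ (distinct (l₁ a) (l₁ a′) (≋⇒≈ᶜ (begin
      cards (l₁ a)                                ≈⟨ ≋-sym (leftCards-≋ a) ⟩
      lift′ (F′F.relabel u-indep (leftCards a))
        ≈⟨ lift-cong′ {c = F′F.relabel u-indep (leftCards a)} (F′F.relabel-cong u-indep {leftCards a} {leftCards a′} (F′F.≈ᶜ⇒≋ eq)) ⟩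
      lift′ (F′F.relabel u-indep (leftCards a′))  ≈⟨ leftCards-≋ a′ ⟩
      cards (l₁ a′)                               ∎)))
      where open FF.≋-Reasoning

    rightCards-distinct : ∀ b b′ → rightCards b H″.≈ᶜ rightCards b′ → b ≡ b′
    rightCards-distinct b b′ eq = inj₂-l₂ (distinct (l₂ b) (l₂ b′) (≋⇒≈ᶜ (begin
      cards (l₂ b)                                ≈⟨ ≋-sym (rightCards-≋ b) ⟩
      lift″ (F″F.relabel w-indep (rightCards b))
        ≈⟨ lift-cong″ {c = F″F.relabel w-indep (rightCards b)} (F″F.relabel-cong w-indep {rightCards b} {rightCards b′} (F″F.≈ᶜ⇒≋ eq)) ⟩
      lift″ (F″F.relabel w-indep (rightCards b′)) ≈⟨ rightCards-≋ b′ ⟩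
      cards (l₂ b′)                               ∎)))
      where open FF.≋-Reasoning

    leftDecomp : DirectSumDecomp (H′.Card.label ∘ leftCards)
    leftDecomp = Decomposes-preimage u-indep leftLabels⊆u
      (Decomposes-select {V = HF.Card.label ∘ cards} (FF.0ᵛ∈label ∘ cards) decomp ρ indep leftLabels⊆u rightLabels⊆w)

    rightDecomp : DirectSumDecomp (H″.Card.label ∘ rightCards)
    rightDecomp = Decomposes-preimage w-indep rightLabels⊆w
      (Decomposes-select {V = HF.Card.label ∘ cards} (FF.0ᵛ∈label ∘ cards) decomp (↔-trans ρ (⊎-comm _ _))
        (LinIndep-++-swap {u = u} {w = w} indep) rightLabels⊆w leftLabels⊆u)

    leftHand : H′.Hand i j
    leftHand = record { cards = leftCards ; distinct = leftCards-distinct ; decomp = leftDecomp }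

    rightHand : H″.Hand i₂ j₂
    rightHand = record { cards = rightCards ; distinct = rightCards-distinct ; decomp = rightDecomp }

    open Merge indep leftHand rightHand using (merged; left; right)

    merged≈H : merged HF.≈ʰ H
    merged≈H = ↔-trans ρ (↔-sym +↔⊎) , λ l → ≋⇒≈ᶜ (match l (to l) refl)
      where
      open FF.≋-Reasoning
      match : ∀ l x → to l ≡ x → HF.Hand.cards merged (Fin.join j j₂ x) ≋ cards l
      match l (inj₁ a) eq = begin
        HF.Hand.cards merged (a ↑ˡ j₂)   ≡⟨ lookup-++ˡ left right a ⟩
        left a                           ≈⟨ leftCards-≋ a ⟩
        cards (l₁ a)                     ≡⟨ cong (cards ∘ from) eq ⟨
        cards (from (to l))              ≡⟨ cong cards (strictlyInverseʳ l) ⟩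
        cards l                          ∎
      match l (inj₂ b) eq = begin
        HF.Hand.cards merged (j ↑ʳ b)    ≡⟨ lookup-++ʳ left right b ⟩
        right b                          ≈⟨ rightCards-≋ b ⟩
        cards (l₂ b)                     ≡⟨ cong (cards ∘ from) eq ⟨
        cards (from (to l))              ≡⟨ cong cards (strictlyInverseʳ l) ⟩
        cards l                          ∎

module DoubleCounting (K : FiniteField) (F′ F″ : Family) (i i₂ j j₂ : ℕ) where
  open FiniteField K using (q)
  open LinAlg K
  open Linear K
  open Counting
  open Merger K F′ F″
  open Extraction K F′ F″

  Typed : Set
  Typed = Σ (HF.Hand (i ℕ.+ i₂) (j ℕ.+ j₂)) (HasType i j)

  IndepBases : Set
  IndepBases = Σ (Bases (i ℕ.+ i₂) i i₂) (λ (u , w) → LinIndep (u ++ᶠ w))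

  Flag : Set
  Flag = Σ Typed (λ (H , _) → Σ (Bases (i ℕ.+ i₂) i i₂) (Adapted H))

  _≈ᶠ_ : Flag → Flag → Set
  x ≈ᶠ y = proj₁ (proj₁ x) HF.≈ʰ proj₁ (proj₁ y) × proj₁ (proj₂ x) ≗ᵇ proj₁ (proj₂ y)

  ≈ᶠ-sym : ∀ {x y} → x ≈ᶠ y → y ≈ᶠ x
  ≈ᶠ-sym {x} {y} (H≈ , b≗) = FF.≈ʰ-sym (proj₁ (proj₁ x)) (proj₁ (proj₁ y)) H≈ , ≗ᵇ-sym b≗

  ≈ᶠ-trans : ∀ {x y z} → x ≈ᶠ y → y ≈ᶠ z → x ≈ᶠ z
  ≈ᶠ-trans {x} {y} {z} (H≈ , b≗) (H≈′ , b≗′) =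
    FF.≈ʰ-trans (proj₁ (proj₁ x)) (proj₁ (proj₁ y)) (proj₁ (proj₁ z)) H≈ H≈′ , ≗ᵇ-trans b≗ b≗′

  flags-by-hands : ∀ {N} ((e , _) : HasCard (HF._≈ʰ_ {i ℕ.+ i₂} {j ℕ.+ j₂}) N) →
    HasCard _≈ᶠ_ (count (hasType? i j ∘ e) ℕ.* (γ q i ℕ.* γ q i₂))
  flags-by-hands hands = HasCard-Σ {R = HF._≈ʰ_ on proj₁} {S = _≗ᵇ_} (λ (H , _) → Adapted H)
    (λ {a} {a′} H≈H′ → Adapted-cong {H = proj₁ a} {proj₁ a′} H≈H′)
    (HasCard-filter hands (hasType? i j) (λ {H} {H′} → HasType-cong {H = H} {H′}))
    (λ (H , leftDim≡ , _) → Fibre.adapted-card H leftDim≡)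

  IndepBases-card : HasCard {IndepBases} (_≗ᵇ_ on proj₁) (γ q (i ℕ.+ i₂))
  IndepBases-card = HasCard-map {R = _≗_ on proj₁} {S = _≗ᵇ_ on proj₁} split-basis
    (λ eq → eq ∘ (_↑ˡ i₂) , eq ∘ (i ↑ʳ_)) (λ (eq , eq′) → ↑-elim eq eq′) surj ≗ᵇ-trans
    (IndepIn-card stdBasis-indep (i ℕ.+ i₂))
    where
    split-basis : IndepIn stdBasis (i ℕ.+ i₂) → IndepBases
    split-basis (U , _ , U-indep) = (u , w) , LinIndep-cong {b′ = u ++ᶠ w} (↑-elim (sym ∘ lookup-++ˡ u w) (sym ∘ lookup-++ʳ u w)) U-indep
      where u = U ∘ (_↑ˡ i₂)
            w = U ∘ (i ↑ʳ_)
    surj : ∀ (b : IndepBases) → ∃ λ U → proj₁ (split-basis U) ≗ᵇ proj₁ b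
    surj ((u , w) , indep) = (u ++ᶠ w , (λ _ → InSpan-stdBasis _) , indep) , lookup-++ˡ u w , lookup-++ʳ u w

  merge : IndepBases × (H′.Hand i j × H″.Hand i₂ j₂) → Flag
  merge (((u , w) , indep) , G′ , G″) = (merged , merged-type) , (u , w) , merged-adapted
    where open Merge indep G′ G″

  flags-by-bases : ∀ {N′ N″} → HasCard (H′._≈ʰ_ {i} {j}) N′ → HasCard (H″._≈ʰ_ {i₂} {j₂}) N″ →
    HasCard _≈ᶠ_ (γ q (i ℕ.+ i₂) ℕ.* (N′ ℕ.* N″))
  flags-by-bases hands′ hands″ = HasCard-map {R = Pointwise (_≗ᵇ_ on proj₁) (Pointwise H′._≈ʰ_ H″._≈ʰ_)} {S = _≈ᶠ_} merge
    (λ {(((_ , _) , indep) , G′₁ , G″₁)} {(((_ , _) , indep′) , G′₂ , G″₂)} (b≗ , G′≈ , G″≈) →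
      MergeCongruence.merged-cong indep indep′ b≗ {G′₁} {G′₂} {G″₁} {G″₂} G′≈ G″≈ , b≗)
    (λ {(((_ , _) , indep) , G′₁ , G″₁)} {(((_ , _) , indep′) , G′₂ , G″₂)} (H≈ , b≗) →
      b≗ , MergeCongruence.merged-injective indep indep′ b≗ {G′₁} {G′₂} {G″₁} {G″₂} H≈)
    (λ ((H , type) , (u , w) , adapted) →
      let open Extract H type adapted in
      (((u , w) , proj₁ adapted) , leftHand , rightHand) , merged≈H , (λ _ → refl) , (λ _ → refl))
    (λ {x} {y} {z} → ≈ᶠ-trans {x} {y} {z})
    (HasCard-× {R = _≗ᵇ_ on proj₁} {S = Pointwise H′._≈ʰ_ H″._≈ʰ_} IndepBases-card
      (HasCard-× {R = H′._≈ʰ_} {S = H″._≈ʰ_} hands′ hands″))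

  double-count : ∀ {N N′ N″} ((e , e-prop) : HasCard (HF._≈ʰ_ {i ℕ.+ i₂} {j ℕ.+ j₂}) N) →
    HasCard (H′._≈ʰ_ {i} {j}) N′ → HasCard (H″._≈ʰ_ {i₂} {j₂}) N″ →
    count (hasType? i j ∘ e) ℕ.* (γ q i ℕ.* γ q i₂) ≡ γ q (i ℕ.+ i₂) ℕ.* (N′ ℕ.* N″)
  double-count hands hands′ hands″ =
    HasCard-unique (λ {x} {y} → ≈ᶠ-sym {x} {y}) (λ {x} {y} {z} → ≈ᶠ-trans {x} {y} {z})
      (flags-by-hands hands) (flags-by-bases hands′ hands″)

module Fractions where
  open import Data.Nat using (_+_; _*_)
  open import Data.Integer using (+_)

  _÷_ : ℕ → (b : ℕ) → .{{NonZero b}} → ℚ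
  a ÷ b = (+ a) ℚ./ b

  _÷ᵘ_ : ℕ → (b : ℕ) → .{{NonZero b}} → ℚᵘ
  a ÷ᵘ b = (+ a) ℚᵘ./ b

  toℚᵘ-÷ : ∀ a b .{{_ : NonZero b}} → toℚᵘ (a ÷ b) ≃ a ÷ᵘ b
  toℚᵘ-÷ a (suc b) = ℚ.toℚᵘ-fromℚᵘ (mkℚᵘ (+ a) b)

  ÷ᵘ-*-÷ᵘ : ∀ a b c d .{{_ : NonZero b}} .{{_ : NonZero d}} → (a ÷ᵘ b) ℚᵘ.* (c ÷ᵘ d) ≃ ((a * c) ÷ᵘ (b * d)) {{ℕ.m*n≢0 b d}}
  ÷ᵘ-*-÷ᵘ a (suc b) c (suc d) = *≡* (cong (ℤ._* (+ suc (d + b * suc d))) (sym (ℤ.pos-* a c)))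

  ÷ᵘ-cong : ∀ a b c d .{{_ : NonZero b}} .{{_ : NonZero d}} → a * d ≡ c * b → a ÷ᵘ b ≃ c ÷ᵘ d
  ÷ᵘ-cong a (suc b) c (suc d) eq = *≡* (trans (sym (ℤ.pos-* a (suc d))) (trans (cong +_ eq) (ℤ.pos-* c (suc b))))

  ÷ᵘ-+-÷ᵘ : ∀ a c b .{{_ : NonZero b}} → (a ÷ᵘ b) ℚᵘ.+ (c ÷ᵘ b) ≃ (a + c) ÷ᵘ b
  ÷ᵘ-+-÷ᵘ a c (suc b) = *≡* (begin
    ((+ a) ℤ.* (+ suc b) ℤ.+ (+ c) ℤ.* (+ suc b)) ℤ.* (+ suc b)
      ≡⟨ cong (ℤ._* (+ suc b)) (cong₂ ℤ._+_ (sym (ℤ.pos-* a (suc b))) (sym (ℤ.pos-* c (suc b)))) ⟩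
    (+ (a * suc b) ℤ.+ + (c * suc b)) ℤ.* (+ suc b)
      ≡⟨ cong (ℤ._* (+ suc b)) (sym (ℤ.pos-+ (a * suc b) (c * suc b))) ⟩
    + (a * suc b + c * suc b) ℤ.* (+ suc b)
      ≡⟨ sym (ℤ.pos-* (a * suc b + c * suc b) (suc b)) ⟩
    + ((a * suc b + c * suc b) * suc b)
      ≡⟨ cong +_ (distrib a c (suc b)) ⟩
    + ((a + c) * (suc b * suc b))
      ≡⟨ ℤ.pos-* (a + c) (suc b * suc b) ⟩
    + (a + c) ℤ.* + (suc b * suc b) ∎)
    where
    open ≡-Reasoning
    distrib : ∀ a c s → (a * s + c * s) * s ≡ (a + c) * (s * s)
    distrib = solve-∀

  ÷-*-÷ : ∀ a b c d .{{_ : NonZero b}} .{{_ : NonZero d}} → (a ÷ b) ℚ.* (c ÷ d) ≡ ((a * c) ÷ (b * d)) {{ℕ.m*n≢0 b d}}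
  ÷-*-÷ a b c d = ℚ.toℚᵘ-injective (ℚᵘ.≃-trans (ℚ.toℚᵘ-homo-* (a ÷ b) (c ÷ d))
    (ℚᵘ.≃-trans (ℚᵘ.*-cong (toℚᵘ-÷ a b) (toℚᵘ-÷ c d))
      (ℚᵘ.≃-trans (÷ᵘ-*-÷ᵘ a b c d) (ℚᵘ.≃-sym (toℚᵘ-÷ (a * c) (b * d) {{ℕ.m*n≢0 b d}})))))

  ÷-cong : ∀ a b c d .{{_ : NonZero b}} .{{_ : NonZero d}} → a * d ≡ c * b → a ÷ b ≡ c ÷ d
  ÷-cong a b c d eq = ℚ.toℚᵘ-injective (ℚᵘ.≃-trans (toℚᵘ-÷ a b) (ℚᵘ.≃-trans (÷ᵘ-cong a b c d eq) (ℚᵘ.≃-sym (toℚᵘ-÷ c d))))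

  ÷-+-÷ : ∀ a c b .{{_ : NonZero b}} → (a ÷ b) ℚ.+ (c ÷ b) ≡ (a + c) ÷ b
  ÷-+-÷ a c b = ℚ.toℚᵘ-injective (ℚᵘ.≃-trans (ℚ.toℚᵘ-homo-+ (a ÷ b) (c ÷ b))
    (ℚᵘ.≃-trans (ℚᵘ.+-cong (toℚᵘ-÷ a b) (toℚᵘ-÷ c b)) (ℚᵘ.≃-trans (÷ᵘ-+-÷ᵘ a c b) (ℚᵘ.≃-sym (toℚᵘ-÷ (a + c) b)))))

module FiniteSums where
  open import Data.Nat using (_+_)
  open Fractions

  sumToℕ : ℕ → (ℕ → ℕ) → ℕ
  sumToℕ zero    f = f 0
  sumToℕ (suc n) f = sumToℕ n f + f (suc n)

  sumTo-÷ : ∀ n (f : ℕ → ℕ) b .{{_ : NonZero b}} → sumTo n (λ i → f i ÷ b) ≡ sumToℕ n f ÷ b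
  sumTo-÷ zero    f b = refl
  sumTo-÷ (suc n) f b = trans (cong (ℚ._+ (f (suc n) ÷ b)) (sumTo-÷ n f b)) (÷-+-÷ (sumToℕ n f) (f (suc n)) b)

  sumTo-cong : ∀ n {f g : ℕ → ℚ} → (∀ i → i ≤ n → f i ≡ g i) → sumTo n f ≡ sumTo n g
  sumTo-cong zero    eq = eq 0 z≤n
  sumTo-cong (suc n) eq = cong₂ ℚ._+_ (sumTo-cong n (λ i i≤n → eq i (ℕ.m≤n⇒m≤1+n i≤n))) (eq (suc n) ℕ.≤-refl)

  sumToℕ-cong : ∀ n {f g : ℕ → ℕ} → (∀ i → i ≤ n → f i ≡ g i) → sumToℕ n f ≡ sumToℕ n g
  sumToℕ-cong zero    eq = eq 0 z≤n
  sumToℕ-cong (suc n) eq = cong₂ _+_ (sumToℕ-cong n (λ i i≤n → eq i (ℕ.m≤n⇒m≤1+n i≤n))) (eq (suc n) ℕ.≤-refl)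

  sumToℕ-zero : ∀ n {f : ℕ → ℕ} → (∀ i → i ≤ n → f i ≡ 0) → sumToℕ n f ≡ 0
  sumToℕ-zero n f≡0 = trans (sumToℕ-cong n f≡0) (zeros n)
    where zeros : ∀ n → sumToℕ n (λ _ → 0) ≡ 0
          zeros zero    = refl
          zeros (suc n) = cong (_+ 0) (zeros n)

  sumToℕ-∑ℕ-comm : ∀ n {N} (F : ℕ → Fin N → ℕ) → sumToℕ n (λ i → ∑ℕ (F i)) ≡ ∑ℕ (λ l → sumToℕ n (λ i → F i l))
  sumToℕ-∑ℕ-comm zero    F = refl
  sumToℕ-∑ℕ-comm (suc n) F =
    trans (cong (_+ ∑ℕ (F (suc n))) (sumToℕ-∑ℕ-comm n F)) (sym (∑ℕ-distrib-+ (λ l → sumToℕ n (λ i → F i l)) (F (suc n))))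

  sumToℕ-indicator : ∀ n {a} (X : ℕ → ℕ) → a ≤ n → sumToℕ n (λ i → if does (a ≟ i) then X i else 0) ≡ X a
  sumToℕ-indicator zero    {zero} X z≤n = refl
  sumToℕ-indicator (suc n) {a}    X a≤1+n with a ≟ suc n
  ... | yes refl = cong₂ _+_
    (sumToℕ-zero n (λ i i≤n → cong (λ b → if b then X i else 0) (dec-false (suc n ≟ i) (ℕ.>⇒≢ (s≤s i≤n)))))
    (cong (λ b → if b then X (suc n) else 0) (dec-true (suc n ≟ suc n) refl))
  ... | no a≢1+n = trans (cong₂ _+_ (sumToℕ-indicator n X (ℕ.≤-pred (ℕ.≤∧≢⇒< a≤1+n a≢1+n)))
                                     (cong (λ b → if b then X (suc n) else 0) (dec-false (a ≟ suc n) a≢1+n)))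
                         (ℕ.+-identityʳ (X a))

  sumToℕ-indicator² : ∀ n k {a b} → a ≤ n → b ≤ k →
    sumToℕ n (λ i → sumToℕ k (λ j → if does (a ≟ i) ∧ does (b ≟ j) then 1 else 0)) ≡ 1
  sumToℕ-indicator² n k {a} {b} a≤n b≤k = trans (sumToℕ-cong n (λ i _ → inner (does (a ≟ i)))) (sumToℕ-indicator n (λ _ → 1) a≤n)
    where
    inner : ∀ x → sumToℕ k (λ j → if x ∧ does (b ≟ j) then 1 else 0) ≡ (if x then 1 else 0)
    inner true  = sumToℕ-indicator k (λ _ → 1) b≤k
    inner false = sumToℕ-zero k (λ _ _ → refl)

module CoefficientIdentity (K : FiniteField) (F′ F″ : Family) where
  open import Data.Nat using (_+_; _*_)
  open FiniteField K using (q)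
  open Counting
  open Merger K F′ F″
  open Fractions
  open FiniteSums

  _÷γ_ : ℕ → ℕ → ℚ
  a ÷γ n = (a ÷ γ q n) {{γ-nonZero K n}}

  hands-by-type : ∀ {n k N} ((e , _) : HasCard (HF._≈ʰ_ {n} {k}) N) →
    sumToℕ n (λ i → sumToℕ k (λ j → count (hasType? i j ∘ e))) ≡ N
  hands-by-type {n} {k} {N} (e , _) = begin
    sumToℕ n (λ i → sumToℕ k (λ j → ∑ℕ (indicator i j)))
      ≡⟨ sumToℕ-cong n (λ i _ → sumToℕ-∑ℕ-comm k (indicator i)) ⟩
    sumToℕ n (λ i → ∑ℕ (λ l → sumToℕ k (λ j → indicator i j l)))
      ≡⟨ sumToℕ-∑ℕ-comm n (λ i l → sumToℕ k (λ j → indicator i j l)) ⟩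
    ∑ℕ (λ l → sumToℕ n (λ i → sumToℕ k (λ j → indicator i j l)))
      ≡⟨ ∑ℕ-cong (λ l → sumToℕ-indicator² n k (leftDim≤n (e l)) (leftCount≤k (e l))) ⟩
    ∑ℕ {N} (λ _ → 1)
      ≡⟨ ∑ℕ-one N ⟩
    N ∎
    where
    open ≡-Reasoning
    indicator = λ i j l → if does (hasType? i j (e l)) then 1 else 0
    leftDim≤n : ∀ H → Type.leftDim H ≤ n
    leftDim≤n H = subst (Type.leftDim H ≤_) (Type.selected-dims H) (ℕ.m≤m+n _ _)
    leftCount≤k : ∀ H → Type.leftCount H ≤ k
    leftCount≤k H = subst (Type.leftCount H ≤_) (count+count-∁ (T? ∘ Type.onLeft H)) (ℕ.m≤m+n _ _)

  type-coefficient : ∀ {n k i i₂ j j₂} → i + i₂ ≡ n → j + j₂ ≡ k →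
    ∀ {N N′ N″} ((e , _) : HasCard (HF._≈ʰ_ {n} {k}) N) →
    HasCard (H′._≈ʰ_ {i} {j}) N′ → HasCard (H″._≈ʰ_ {i₂} {j₂}) N″ →
    count (hasType? i j ∘ e) ÷γ n ≡ (N′ ÷γ i) ℚ.* (N″ ÷γ i₂)
  type-coefficient {i = i} {i₂} {j} {j₂} refl refl {N′ = N′} {N″} hands hands′ hands″ = sym (begin
    (N′ ÷γ i) ℚ.* (N″ ÷γ i₂)                        ≡⟨ ÷-*-÷ N′ (γ q i) N″ (γ q i₂) ⟩
    ((N′ * N″) ÷ (γ q i * γ q i₂)) {{γᵢγᵢ₂≢0}}
      ≡⟨ ÷-cong (N′ * N″) (γ q i * γ q i₂) (count (hasType? i j ∘ proj₁ hands)) (γ q (i + i₂)) {{γᵢγᵢ₂≢0}} cross ⟩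
    count (hasType? i j ∘ proj₁ hands) ÷γ (i + i₂)  ∎)
    where
    open ≡-Reasoning
    instance
      γᵢ≢0 = γ-nonZero K i
      γᵢ₂≢0 = γ-nonZero K i₂
      γₙ≢0 = γ-nonZero K (i + i₂)
    γᵢγᵢ₂≢0 = ℕ.m*n≢0 (γ q i) (γ q i₂)
    cross : N′ * N″ * γ q (i + i₂) ≡ count (hasType? i j ∘ proj₁ hands) * (γ q i * γ q i₂)
    cross = trans (ℕ.*-comm (N′ * N″) _) (sym (DoubleCounting.double-count K F′ F″ i i₂ j j₂ hands hands′ hands″))

mainTheorem1 : (K : FiniteField) (F′ F″ : Family)
    → FiniteDecks F′ → FiniteDecks F″
    → (h h′ h″ : ℕ → ℕ → ℕ)
    → IsHandCount K (F′ ⊕ F″) h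
    → IsHandCount K F′ h′
    → IsHandCount K F″ h″
    → ∀ n k → coeff K h n k ≡ productCoeff (coeff K h′) (coeff K h″) n k
mainTheorem1 K F′ F″ _ _ h h′ h″ hands hands′ hands″ n k = begin
  h n k ÷γ n                                                 ≡⟨ cong (_÷γ n) (sym (hands-by-type (hands n k))) ⟩
  sumToℕ n (λ i → sumToℕ k (λ j → typed i j)) ÷γ n          ≡⟨ sym (sumTo-÷ n _ (γ q n)) ⟩
  sumTo n (λ i → sumToℕ k (λ j → typed i j) ÷γ n)           ≡⟨ sumTo-cong n (λ i _ → sym (sumTo-÷ k _ (γ q n))) ⟩
  sumTo n (λ i → sumTo k (λ j → typed i j ÷γ n))            ≡⟨ sumTo-cong n (λ i i≤n → sumTo-cong k (λ j j≤k →
                                                                  type-coefficient (ℕ.m+[n∸m]≡n i≤n) (ℕ.m+[n∸m]≡n j≤k)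
                                                                    (hands n k) (hands′ i j) (hands″ (n ∸ i) (k ∸ j)))) ⟩
  productCoeff (coeff K h′) (coeff K h″) n k                 ∎
  where
  open ≡-Reasoning
  open FiniteField K using (q)
  open CoefficientIdentity K F′ F″
  open FiniteSums
  open Fractions
  open Counting
  open Merger K F′ F″ using (hasType?)
  typed = λ i j → count (hasType? i j ∘ proj₁ (hands n k))
  instance γₙ≢0 = γ-nonZero K n
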